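{- For every integer $n\geq3$, \begin{align*} CP_{(3,1)}(n)=&\frac{1+q^{2n-3}+q^{2n-2}+q^{2n-1}}{(1-q^{2n-1})(1-q^{2n})}CP_{(3,1)}(n-1) -\frac{q^{4n-5}+q^{4n-6}+q^{4n-7}}{(1-q^{2n-3})(1-q^{2n-2})(1-q^{2n-1})(1-q^{2n})}CP_{(3,1)}(n-2)\\ &-\frac{q^{4n-8}}{(1-q^{2n-5})(1-q^{2n-3})(1-q^{2n-2})(1-q^{2n-1})(1-q^{2n})}CP_{(3,1)}(n-3). \end{align*}
   Context: A cylindric partition with profile $(c_1,c_2)$ is a pair of partitions $(\lambda^{(1)},\lambda^{(2)})$ (parts weakly decreasing, $\lambda^{(i)}_j=0$ beyond the number of parts) with $\lambda^{(1)}_j\ge\lambda^{(2)}_{j+c_2}$ and $\lambda^{(2)}_j\ge\lambda^{(1)}_{j+c_1}$ for all $j\ge1$; its size is $|\lambda^{(1)}|+|\lambda^{(2)}|$. $CP_{(3,1)}(n)$ is the generating function $\sum q^{\text{size}}$ over cylindric partitions of profile $(3,1)$ in which each partition has at most $n$ parts, with $CP_{(3,1)}(0)=1$. -}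

module Defs where

open import Data.Nat as ℕ using (ℕ; zero; suc; _∸_; _≥_; _≡ᵇ_)
open import Data.Nat.Divisibility using (_∣?_)
open import Data.Integer as ℤ using (ℤ; +_)
open import Data.List using (List; []; _∷_; map; concatMap; upTo; length; filter; cartesianProduct; foldr)
open import Data.Nat.ListAction using (sum)
open import Data.List.Relation.Unary.All using (All; all?)
open import Data.Product using (_×_; _,_; proj₁; proj₂)
open import Data.Bool using (if_then_else_)
open import Relation.Binary.PropositionalEquality using (_≡_)
open import Relation.Nullary using (Dec; yes; no; does)
open import Relation.Nullary.Decidable using (_×-dec_)

-- Formal power series in q with integer coefficients: coefficient maps.

PS : Set
PS = ℕ → ℤ

infix 4 _≈_
_≈_ : PS → PS → Set
f ≈ g = ∀ m → f m ≡ g m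

infixl 6 _⊕_ _⊖_
infixl 7 _⊛_

_⊕_ : PS → PS → PS
(f ⊕ g) m = f m ℤ.+ g m

_⊖_ : PS → PS → PS
(f ⊖ g) m = f m ℤ.- g m

sumℤ : List ℤ → ℤ
sumℤ = foldr ℤ._+_ (+ 0)

_⊛_ : PS → PS → PS
(f ⊛ g) m = sumℤ (map (λ i → f i ℤ.* g (m ∸ i)) (upTo (suc m)))

q^ : ℕ → PS
q^ k m = if k ≡ᵇ m then + 1 else + 0

-- the series 1/(1 - q^k) = Σ_{j≥0} q^{jk}  (used only for k ≥ 1,
-- where its coefficient of q^m is 1 iff k ∣ m)
inv1m : ℕ → PS
inv1m k m = if does (k ∣? m) then + 1 else + 0

-- Cylindric partitions of profile (3,1) with at most n parts per partition.
-- A partition with at most n parts is encoded as a weakly decreasing list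
-- of exactly n naturals (padded with zeros).

-- 0-indexed lookup with default 0 (entries beyond the list are 0)
at : List ℕ → ℕ → ℕ
at [] _ = 0
at (x ∷ xs) zero = x
at (x ∷ xs) (suc j) = at xs j

vecs : ℕ → ℕ → List (List ℕ)
vecs zero b = [] ∷ []
vecs (suc n) b = concatMap (λ x → map (x ∷_) (vecs n b)) (upTo (suc b))

-- weakly decreasing (indices 0..n-1, with λ_{n+1} = 0)
Decreasing : ℕ → List ℕ → Set
Decreasing n l = All (λ j → at l j ≥ at l (suc j)) (upTo n)

-- cylindric conditions for profile (c₁,c₂) = (3,1):
--   λ⁽¹⁾_j ≥ λ⁽²⁾_{j+1},  λ⁽²⁾_j ≥ λ⁽¹⁾_{j+3}  for all j
-- (for j beyond n both sides vanish, so only j < n matters)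
Cyl31 : ℕ → List ℕ → List ℕ → Set
Cyl31 n l1 l2 =
  All (λ j → at l1 j ≥ at l2 (j ℕ.+ 1)) (upTo n) ×
  All (λ j → at l2 j ≥ at l1 (j ℕ.+ 3)) (upTo n)

IsCP31 : ℕ → ℕ → List ℕ × List ℕ → Set
IsCP31 n m (l1 , l2) =
  Decreasing n l1 × Decreasing n l2 × Cyl31 n l1 l2 × (sum l1 ℕ.+ sum l2 ≡ m)

isCP31? : ∀ n m p → Dec (IsCP31 n m p)
isCP31? n m (l1 , l2) =
  all? (λ j → at l1 (suc j) ℕ.≤? at l1 j) (upTo n) ×-dec
  all? (λ j → at l2 (suc j) ℕ.≤? at l2 j) (upTo n) ×-dec
  (all? (λ j → at l2 (j ℕ.+ 1) ℕ.≤? at l1 j) (upTo n) ×-dec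
   all? (λ j → at l1 (j ℕ.+ 3) ℕ.≤? at l2 j) (upTo n)) ×-dec
  (sum l1 ℕ.+ sum l2 ℕ.≟ m)

-- number of cylindric partitions of profile (3,1), at most n parts each,
-- of size m (every part is ≤ m, so enumerating entries in {0..m} is complete)
cp31count : ℕ → ℕ → ℕ
cp31count n m = length (filter (isCP31? n m) (cartesianProduct (vecs n m) (vecs n m)))

CP31 : ℕ → PS
CP31 n m = + cp31count n m

module Submission where

-- Let P(r, s) be the generating function of the cylindric pairs of profile (3,1) whose
-- partitions have at most r and s parts, so that CP(n) = P(n, n). When s ≤ r + 1 and
-- r ≤ s + 3, removing one from every part is a bijection from the pairs with r and s
-- nonzero parts onto all pairs, so these contribute q^(r+s) P(r, s). Every other pair
-- loses its last part in one of the two partitions, and inclusion–exclusion gives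
--   (1 - q^(r+s+2)) P(r+1, s+1) = P(r, s+1) + P(r+1, s) - P(r, s),
-- while in the shapes (r, r+1) and (s+3, s) the interlacing conditions force one
-- particular partition to lose a part:
--   (1 - q^(2r+1)) P(r, r+1) = P(r, r),   (1 - q^(2s+3)) P(s+3, s) = P(s+2, s).
-- Ten of these relations around the diagonal, for n - 3 ≤ r, s ≤ n, eliminate every
-- off-diagonal P and leave a linear relation between CP(n), ..., CP(n-3) whose
-- coefficients are polynomials; dividing by the factors 1 - q^e gives the theorem.

open import Defs

module CauchyProduct where

  open import Data.Integer as ℤ using (ℤ; _+_; _*_; -_; 0ℤ; 1ℤ)
  import Data.Integer.Properties as ℤ
  open import Data.Integer.Solver using (module +-*-Solver)
  open import Data.List using (List; _∷_; map; applyUpTo)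
  open import Data.Nat as ℕ using (ℕ; zero; suc; _∸_; _<_; s≤s)
  open import Function using (_∘_; id)
  open import Relation.Binary.PropositionalEquality
  open +-*-Solver using (solve; _:=_; _:+_; _:*_; con)

  0ₚ : PS
  0ₚ _ = 0ℤ

  -ₚ_ : PS → PS
  (-ₚ f) m = - f m

  infixr 8 _·_
  _·_ : ℤ → PS → PS
  (c · f) m = c * f m

  map-applyUpTo : ∀ (h : ℕ → ℤ) g n → map h (applyUpTo g n) ≡ applyUpTo (h ∘ g) n
  map-applyUpTo h g zero    = refl
  map-applyUpTo h g (suc n) = cong (h (g 0) ∷_) (map-applyUpTo h (g ∘ suc) n)

  ⊛-suc : ∀ f g m → (f ⊛ g) (suc m) ≡ f 0 * g (suc m) + ((f ∘ suc) ⊛ g) m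
  ⊛-suc f g m = cong (λ xs → f 0 * g (suc m) + sumℤ xs)
    (trans (map-applyUpTo term suc (suc m)) (sym (map-applyUpTo (term ∘ suc) id (suc m))))
    where
    term : ℕ → ℤ
    term i = f i * g (suc m ∸ i)

  ⊛-cong : ∀ {f f′ g g′} → f ≈ f′ → g ≈ g′ → f ⊛ g ≈ f′ ⊛ g′
  ⊛-cong f≈ g≈ zero = cong (_+ 0ℤ) (cong₂ _*_ (f≈ 0) (g≈ 0))
  ⊛-cong {f} {f′} {g} {g′} f≈ g≈ (suc m) = begin
    (f ⊛ g) (suc m)                          ≡⟨ ⊛-suc f g m ⟩
    f 0 * g (suc m) + ((f ∘ suc) ⊛ g) m      ≡⟨ cong₂ _+_ (cong₂ _*_ (f≈ 0) (g≈ (suc m)))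
                                                          (⊛-cong (f≈ ∘ suc) g≈ m) ⟩
    f′ 0 * g′ (suc m) + ((f′ ∘ suc) ⊛ g′) m  ≡⟨ ⊛-suc f′ g′ m ⟨
    (f′ ⊛ g′) (suc m)                        ∎
    where open ≡-Reasoning

  ⊛-zeroˡ : ∀ g → 0ₚ ⊛ g ≈ 0ₚ
  ⊛-zeroˡ g zero    = cong (_+ 0ℤ) (ℤ.*-zeroˡ (g 0))
  ⊛-zeroˡ g (suc m) = trans (⊛-suc 0ₚ g m) (cong₂ _+_ (ℤ.*-zeroˡ (g (suc m))) (⊛-zeroˡ g m))

  ⊛-distribʳ : ∀ h f g → (f ⊕ g) ⊛ h ≈ f ⊛ h ⊕ g ⊛ h
  ⊛-distribʳ h f g zero = solve 3 (λ a b c → (a :+ b) :* c :+ con 0ℤ := (a :* c :+ con 0ℤ) :+ (b :* c :+ con 0ℤ))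
    refl (f 0) (g 0) (h 0)
  ⊛-distribʳ h f g (suc m) = begin
    ((f ⊕ g) ⊛ h) (suc m)
      ≡⟨ ⊛-suc (f ⊕ g) h m ⟩
    (f 0 + g 0) * h (suc m) + (((f ∘ suc) ⊕ (g ∘ suc)) ⊛ h) m
      ≡⟨ cong (((f 0 + g 0) * h (suc m)) +_) (⊛-distribʳ h (f ∘ suc) (g ∘ suc) m) ⟩
    (f 0 + g 0) * h (suc m) + (((f ∘ suc) ⊛ h) m + ((g ∘ suc) ⊛ h) m)
      ≡⟨ solve 5 (λ a b c x y → (a :+ b) :* c :+ (x :+ y) := (a :* c :+ x) :+ (b :* c :+ y)) refl (f 0) (g 0) (h (suc m)) _ _ ⟩
    (f 0 * h (suc m) + ((f ∘ suc) ⊛ h) m) + (g 0 * h (suc m) + ((g ∘ suc) ⊛ h) m)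
      ≡⟨ cong₂ _+_ (⊛-suc f h m) (⊛-suc g h m) ⟨
    (f ⊛ h ⊕ g ⊛ h) (suc m)
      ∎
    where open ≡-Reasoning

  ⊛-scaleˡ : ∀ c f g → (c · f) ⊛ g ≈ c · (f ⊛ g)
  ⊛-scaleˡ c f g zero = solve 3 (λ c a b → c :* a :* b :+ con 0ℤ := c :* (a :* b :+ con 0ℤ)) refl c (f 0) (g 0)
  ⊛-scaleˡ c f g (suc m) = begin
    ((c · f) ⊛ g) (suc m)                          ≡⟨ ⊛-suc (c · f) g m ⟩
    c * f 0 * g (suc m) + ((c · (f ∘ suc)) ⊛ g) m  ≡⟨ cong ((c * f 0 * g (suc m)) +_) (⊛-scaleˡ c (f ∘ suc) g m) ⟩
    c * f 0 * g (suc m) + c * ((f ∘ suc) ⊛ g) m    ≡⟨ solve 4 (λ c a b x → c :* a :* b :+ c :* x := c :* (a :* b :+ x))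
                                                        refl c (f 0) (g (suc m)) _ ⟩
    c * (f 0 * g (suc m) + ((f ∘ suc) ⊛ g) m)      ≡⟨ cong (c *_) (⊛-suc f g m) ⟨
    (c · (f ⊛ g)) (suc m)                          ∎
    where open ≡-Reasoning

  ⊛-assoc : ∀ f g h → (f ⊛ g) ⊛ h ≈ f ⊛ (g ⊛ h)
  ⊛-assoc f g h zero = solve 3 (λ a b c → (a :* b :+ con 0ℤ) :* c :+ con 0ℤ := a :* (b :* c :+ con 0ℤ) :+ con 0ℤ)
    refl (f 0) (g 0) (h 0)
  ⊛-assoc f g h (suc m) = begin
    ((f ⊛ g) ⊛ h) (suc m)
      ≡⟨ ⊛-suc (f ⊛ g) h m ⟩
    (f ⊛ g) 0 * h (suc m) + (((f ⊛ g) ∘ suc) ⊛ h) m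
      ≡⟨ cong (((f ⊛ g) 0 * h (suc m)) +_) tail ⟩
    (f 0 * g 0 + 0ℤ) * h (suc m) + (f 0 * ((g ∘ suc) ⊛ h) m + ((f ∘ suc) ⊛ (g ⊛ h)) m)
      ≡⟨ solve 5 (λ a b c x y → (a :* b :+ con 0ℤ) :* c :+ (a :* x :+ y) := a :* (b :* c :+ x) :+ y)
           refl (f 0) (g 0) (h (suc m)) _ _ ⟩
    f 0 * (g 0 * h (suc m) + ((g ∘ suc) ⊛ h) m) + ((f ∘ suc) ⊛ (g ⊛ h)) m
      ≡⟨ cong (λ z → f 0 * z + ((f ∘ suc) ⊛ (g ⊛ h)) m) (⊛-suc g h m) ⟨
    f 0 * (g ⊛ h) (suc m) + ((f ∘ suc) ⊛ (g ⊛ h)) m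
      ≡⟨ ⊛-suc f (g ⊛ h) m ⟨
    (f ⊛ (g ⊛ h)) (suc m)
      ∎
    where
    open ≡-Reasoning
    tail : (((f ⊛ g) ∘ suc) ⊛ h) m ≡ f 0 * ((g ∘ suc) ⊛ h) m + ((f ∘ suc) ⊛ (g ⊛ h)) m
    tail = begin
      (((f ⊛ g) ∘ suc) ⊛ h) m                            ≡⟨ ⊛-cong {g = h} (⊛-suc f g) (λ _ → refl) m ⟩
      ((f 0 · (g ∘ suc) ⊕ (f ∘ suc) ⊛ g) ⊛ h) m          ≡⟨ ⊛-distribʳ h (f 0 · (g ∘ suc)) ((f ∘ suc) ⊛ g) m ⟩
      ((f 0 · (g ∘ suc)) ⊛ h) m + (((f ∘ suc) ⊛ g) ⊛ h) m ≡⟨ cong₂ _+_ (⊛-scaleˡ (f 0) (g ∘ suc) h m)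
                                                                      (⊛-assoc (f ∘ suc) g h m) ⟩
      f 0 * ((g ∘ suc) ⊛ h) m + ((f ∘ suc) ⊛ (g ⊛ h)) m  ∎

  ⊛-sucʳ : ∀ f g m → (f ⊛ g) (suc m) ≡ f (suc m) * g 0 + (f ⊛ (g ∘ suc)) m
  ⊛-sucʳ f g zero = solve 4 (λ a b c d → a :* b :+ (c :* d :+ con 0ℤ) := c :* d :+ (a :* b :+ con 0ℤ))
    refl (f 0) (g 1) (f 1) (g 0)
  ⊛-sucʳ f g (suc m) = begin
    (f ⊛ g) (suc (suc m))
      ≡⟨ ⊛-suc f g (suc m) ⟩
    f 0 * g (suc (suc m)) + ((f ∘ suc) ⊛ g) (suc m)
      ≡⟨ cong ((f 0 * g (suc (suc m))) +_) (⊛-sucʳ (f ∘ suc) g m) ⟩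
    f 0 * g (suc (suc m)) + (f (suc (suc m)) * g 0 + ((f ∘ suc) ⊛ (g ∘ suc)) m)
      ≡⟨ solve 5 (λ a b c d x → a :* b :+ (c :* d :+ x) := c :* d :+ (a :* b :+ x))
           refl (f 0) (g (suc (suc m))) (f (suc (suc m))) (g 0) _ ⟩
    f (suc (suc m)) * g 0 + (f 0 * g (suc (suc m)) + ((f ∘ suc) ⊛ (g ∘ suc)) m)
      ≡⟨ cong ((f (suc (suc m)) * g 0) +_) (⊛-suc f (g ∘ suc) m) ⟨
    f (suc (suc m)) * g 0 + (f ⊛ (g ∘ suc)) (suc m)
      ∎
    where open ≡-Reasoning

  ⊛-comm : ∀ f g → f ⊛ g ≈ g ⊛ f
  ⊛-comm f g zero    = cong (_+ 0ℤ) (ℤ.*-comm (f 0) (g 0))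
  ⊛-comm f g (suc m) = begin
    (f ⊛ g) (suc m)                      ≡⟨ ⊛-suc f g m ⟩
    f 0 * g (suc m) + ((f ∘ suc) ⊛ g) m  ≡⟨ cong₂ _+_ (ℤ.*-comm (f 0) (g (suc m))) (⊛-comm (f ∘ suc) g m) ⟩
    g (suc m) * f 0 + (g ⊛ (f ∘ suc)) m  ≡⟨ ⊛-sucʳ g f m ⟨
    (g ⊛ f) (suc m)                      ∎
    where open ≡-Reasoning

  shift : ℕ → PS → PS
  shift zero    f         = f
  shift (suc k) f zero    = 0ℤ
  shift (suc k) f (suc m) = shift k f m

  shift-< : ∀ k f m → m < k → shift k f m ≡ 0ℤ
  shift-< (suc k) f zero    _       = refl
  shift-< (suc k) f (suc m) (s≤s p) = shift-< k f m p

  shift-+ : ∀ k f m → shift k f (k ℕ.+ m) ≡ f m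
  shift-+ zero    f m = refl
  shift-+ (suc k) f m = shift-+ k f m

  q^-⊛ : ∀ k f → q^ k ⊛ f ≈ shift k f
  q^-⊛ zero    f zero    = trans (ℤ.+-identityʳ _) (ℤ.*-identityˡ (f 0))
  q^-⊛ zero    f (suc m) = begin
    (q^ 0 ⊛ f) (suc m)           ≡⟨ ⊛-suc (q^ 0) f m ⟩
    1ℤ * f (suc m) + (0ₚ ⊛ f) m  ≡⟨ cong₂ _+_ (ℤ.*-identityˡ (f (suc m))) (⊛-zeroˡ f m) ⟩
    f (suc m) + 0ℤ               ≡⟨ ℤ.+-identityʳ (f (suc m)) ⟩
    f (suc m)                    ∎
    where open ≡-Reasoning
  q^-⊛ (suc k) f zero    = refl
  q^-⊛ (suc k) f (suc m) = begin
    (q^ (suc k) ⊛ f) (suc m)            ≡⟨ ⊛-suc (q^ (suc k)) f m ⟩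
    0ℤ * f (suc m) + (q^ k ⊛ f) m       ≡⟨ ℤ.+-identityˡ _ ⟩
    (q^ k ⊛ f) m                        ≡⟨ q^-⊛ k f m ⟩
    shift k f m                         ∎
    where open ≡-Reasoning

module SeriesRing where

  open CauchyProduct hiding (⊛-cong)
  open import Algebra.Bundles using (CommutativeRing)
  open import Algebra.Structures using (IsCommutativeRing)
  import Algebra.Solver.Ring
  import Algebra.Solver.Ring.AlmostCommutativeRing as ACR
  open import Data.Bool using (if_then_else_)
  open import Data.Integer as ℤ using (ℤ; _+_; _-_; _*_; -_; 0ℤ; 1ℤ)
  import Data.Integer.Properties as ℤ
  open import Data.Maybe using (Maybe; just; nothing)
  open import Data.Nat as ℕ using (ℕ; zero; suc; _≡ᵇ_)
  import Data.Nat.Properties as ℕ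
  open import Data.Nat.Divisibility using (_∣?_; ∣m∣n⇒∣m+n; ∣m+n∣m⇒∣n; ∣-refl; >⇒∤; _∣0)
  open import Data.Product using (_,_)
  open import Function.Bundles using (mk⇔)
  open import Level using (0ℓ)
  open import Relation.Binary.PropositionalEquality
  open import Relation.Nullary using (yes; no)
  open import Relation.Nullary.Decidable using (dec-true; dec-false; does-⇔)

  -- Coefficientwise equality wrapped in a record, which Agda does not unfold to a
  -- Π-type, so the two sides of an equation can be inferred. Series occurring
  -- under ⊛ still cannot, which is why several lemmas below take them explicitly.
  infix 4 _≋_
  record _≋_ (f g : PS) : Set where
    constructor ≈⇒≋
    field ≋⇒≈ : f ≈ g
  open _≋_ public

  ≋-refl : ∀ {f} → f ≋ f
  ≋-refl = ≈⇒≋ λ _ → refl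

  ≋-sym : ∀ {f g} → f ≋ g → g ≋ f
  ≋-sym (≈⇒≋ f≈g) = ≈⇒≋ λ m → sym (f≈g m)

  ≋-trans : ∀ {f g h} → f ≋ g → g ≋ h → f ≋ h
  ≋-trans (≈⇒≋ f≈g) (≈⇒≋ g≈h) = ≈⇒≋ λ m → trans (f≈g m) (g≈h m)

  ⊕-cong : ∀ {f f′ g g′} → f ≋ f′ → g ≋ g′ → f ⊕ g ≋ f′ ⊕ g′
  ⊕-cong (≈⇒≋ f≈) (≈⇒≋ g≈) = ≈⇒≋ λ m → cong₂ _+_ (f≈ m) (g≈ m)

  ⊖-cong : ∀ {f f′ g g′} → f ≋ f′ → g ≋ g′ → f ⊖ g ≋ f′ ⊖ g′
  ⊖-cong (≈⇒≋ f≈) (≈⇒≋ g≈) = ≈⇒≋ λ m → cong₂ _-_ (f≈ m) (g≈ m)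

  ⊛-cong : ∀ {f f′ g g′} → f ≋ f′ → g ≋ g′ → f ⊛ g ≋ f′ ⊛ g′
  ⊛-cong (≈⇒≋ f≈) (≈⇒≋ g≈) = ≈⇒≋ (CauchyProduct.⊛-cong f≈ g≈)

  +-*-isCommutativeRing : IsCommutativeRing _≋_ _⊕_ _⊛_ -ₚ_ 0ₚ (q^ 0)
  +-*-isCommutativeRing = record
    { isRing = record
      { +-isAbelianGroup = record
        { isGroup = record
          { isMonoid = record
            { isSemigroup = record
              { isMagma  = record { isEquivalence = record { refl = ≋-refl ; sym = ≋-sym ; trans = ≋-trans }
                                  ; ∙-cong = ⊕-cong }
              ; assoc    = λ f g h → ≈⇒≋ λ m → ℤ.+-assoc (f m) (g m) (h m) }
            ; identity = (λ f → ≈⇒≋ λ m → ℤ.+-identityˡ (f m)) , (λ f → ≈⇒≋ λ m → ℤ.+-identityʳ (f m)) }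
          ; inverse = (λ f → ≈⇒≋ λ m → ℤ.+-inverseˡ (f m)) , (λ f → ≈⇒≋ λ m → ℤ.+-inverseʳ (f m))
          ; ⁻¹-cong = λ (≈⇒≋ f≈) → ≈⇒≋ λ m → cong -_ (f≈ m) }
        ; comm = λ f g → ≈⇒≋ λ m → ℤ.+-comm (f m) (g m) }
      ; *-cong     = ⊛-cong
      ; *-assoc    = λ f g h → ≈⇒≋ (⊛-assoc f g h)
      ; *-identity = (λ f → ≈⇒≋ (q^-⊛ 0 f)) , (λ f → ≈⇒≋ λ m → trans (⊛-comm f (q^ 0) m) (q^-⊛ 0 f m))
      ; distrib    = (λ f g h → ≈⇒≋ λ m → trans (⊛-comm f (g ⊕ h) m)
                                            (trans (⊛-distribʳ f g h m) (cong₂ _+_ (⊛-comm g f m) (⊛-comm h f m))))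
                   , (λ f g h → ≈⇒≋ (⊛-distribʳ f g h)) }
    ; *-comm = λ f g → ≈⇒≋ (⊛-comm f g) }

  commutativeRing : CommutativeRing 0ℓ 0ℓ
  commutativeRing = record { isCommutativeRing = +-*-isCommutativeRing }

  -- Constant series. ι 1ℤ and q^ 0 agree by definition, so solver terms built
  -- from con 1ℤ match the series q^ 0 ⊖ x of the statement.
  ι : ℤ → PS
  ι c m = if 0 ≡ᵇ m then c else 0ℤ

  ι-homomorphism : CommutativeRing.rawRing ℤ.+-*-commutativeRing
                     ACR.-Raw-AlmostCommutative⟶ ACR.fromCommutativeRing commutativeRing
  ι-homomorphism = record
    { ⟦_⟧    = ι
    ; +-homo = λ a b → ≈⇒≋ λ { zero → refl ; (suc m) → refl }
    ; *-homo = λ a b → ≈⇒≋ λ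
        { zero    → sym (ℤ.+-identityʳ (a * b))
        ; (suc m) → sym (trans (⊛-suc (ι a) (ι b) m) (cong₂ _+_ (ℤ.*-zeroʳ a) (⊛-zeroˡ (ι b) m))) }
    ; -‿homo = λ a → ≈⇒≋ λ { zero → refl ; (suc m) → refl }
    ; 0-homo = ≈⇒≋ λ { zero → refl ; (suc m) → refl }
    ; 1-homo = ≈⇒≋ λ { zero → refl ; (suc m) → refl } }

  ι-≟ : ∀ a b → Maybe (ι a ≋ ι b)
  ι-≟ a b with a ℤ.≟ b
  ... | yes refl = just ≋-refl
  ... | no _     = nothing

  module Solver = Algebra.Solver.Ring (CommutativeRing.rawRing ℤ.+-*-commutativeRing)
    (ACR.fromCommutativeRing commutativeRing) ι-homomorphism ι-≟
  open Solver using (solve; _:=_; _:+_; _:-_; _:*_; con; Polynomial)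

  infix 8 1-_
  1-_ : PS → PS
  1- x = q^ 0 ⊖ x

  infix 9 :1-_
  :1-_ : ∀ {n} → Polynomial n → Polynomial n
  :1- x = con 1ℤ :- x

  q^-+ : ∀ a b → q^ a ⊛ q^ b ≋ q^ (a ℕ.+ b)
  q^-+ a b = ≈⇒≋ λ m → trans (q^-⊛ a (q^ b) m) (shift-q^ a m)
    where
    shift-q^ : ∀ a m → shift a (q^ b) m ≡ q^ (a ℕ.+ b) m
    shift-q^ zero    m       = refl
    shift-q^ (suc a) zero    = refl
    shift-q^ (suc a) (suc m) = shift-q^ a m

  inv1m-+ : ∀ k j → inv1m (suc k) (suc k ℕ.+ j) ≡ inv1m (suc k) j
  inv1m-+ k j = cong (if_then 1ℤ else 0ℤ)
    (does-⇔ (mk⇔ (λ d → ∣m+n∣m⇒∣n d ∣-refl) (∣m∣n⇒∣m+n ∣-refl)) (suc k ∣? (suc k ℕ.+ j)) (suc k ∣? j))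

  inv1m-< : ∀ k m → suc m ℕ.< suc k → inv1m (suc k) (suc m) ≡ 0ℤ
  inv1m-< k m m<k = cong (if_then 1ℤ else 0ℤ) (dec-false (suc k ∣? suc m) (>⇒∤ m<k))

  inv1m-inverse : ∀ k → (1- q^ (suc k)) ⊛ inv1m (suc k) ≋ q^ 0
  inv1m-inverse k = begin
    (1- q^ (suc k)) ⊛ I  ≈⟨ solve 2 (λ x y → :1- x :* y := y :- x :* y) ≋-refl (q^ (suc k)) I ⟩
    I ⊖ q^ (suc k) ⊛ I   ≈⟨ ≈⇒≋ (λ m → cong (_-_ (I m)) (q^-⊛ (suc k) I m)) ⟩
    I ⊖ shift (suc k) I  ≈⟨ ≈⇒≋ periodic ⟩
    q^ 0                 ∎
    where
    open import Relation.Binary.Reasoning.Setoid (CommutativeRing.setoid commutativeRing)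
    I : PS
    I = inv1m (suc k)
    periodic : I ⊖ shift (suc k) I ≈ q^ 0
    periodic zero = cong (if_then 1ℤ else 0ℤ) (dec-true (suc k ∣? 0) (suc k ∣0))
    periodic (suc m) with suc m ℕ.<? suc k
    ... | yes m<k = cong₂ _-_ (inv1m-< k m m<k) (shift-< (suc k) I (suc m) m<k)
    ... | no  m≮k with o , refl ← ℕ.m≤n⇒∃[o]m+o≡n (ℕ.≮⇒≥ m≮k) =
      trans (cong₂ _-_ (inv1m-+ k o) (shift-+ (suc k) I o)) (ℤ.+-inverseʳ (I o))

  Vanishes : PS → Set
  Vanishes d = d ≋ 0ₚ

  vanishes : ∀ {f g} → f ≋ g → Vanishes (f ⊖ g)
  vanishes {f} {g} (≈⇒≋ f≈g) = ≈⇒≋ λ m → trans (cong (λ x → x - g m) (f≈g m)) (ℤ.+-inverseʳ (g m))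

  infixl 6 _+ᵛ_ _-ᵛ_
  infixr 7 _·ᵛ_

  _+ᵛ_ : ∀ {d e} → Vanishes d → Vanishes e → Vanishes (d ⊕ e)
  ≈⇒≋ d≈0 +ᵛ ≈⇒≋ e≈0 = ≈⇒≋ λ m → cong₂ _+_ (d≈0 m) (e≈0 m)

  _-ᵛ_ : ∀ {d e} → Vanishes d → Vanishes e → Vanishes (d ⊖ e)
  ≈⇒≋ d≈0 -ᵛ ≈⇒≋ e≈0 = ≈⇒≋ λ m → cong₂ _-_ (d≈0 m) (e≈0 m)

  _·ᵛ_ : ∀ c {d} → Vanishes d → Vanishes (c ⊛ d)
  c ·ᵛ d≈0 = ≋-trans (⊛-cong (≋-refl {c}) d≈0) (≈⇒≋ λ m → trans (⊛-comm c 0ₚ m) (⊛-zeroˡ c m))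

  linear-combination : ∀ {f g d} → f ⊖ g ≋ d → Vanishes d → f ≋ g
  linear-combination {f} {g} (≈⇒≋ f-g≈d) (≈⇒≋ d≈0) =
    ≈⇒≋ λ m → ℤ.i-j≡0⇒i≡j (f m) (g m) (trans (f-g≈d m) (d≈0 m))

  divide-by : ∀ u v f g → u ⊛ v ≋ q^ 0 → u ⊛ f ≋ g → f ≋ v ⊛ g
  divide-by u v f g uv≋1 uf≋g = linear-combination
    (solve 4 (λ u v f g → f :- v :* g := v :* (u :* f :- g) :- f :* (u :* v :- con 1ℤ)) ≋-refl u v f g)
    (v ·ᵛ vanishes uf≋g -ᵛ f ·ᵛ vanishes uv≋1)

  units-⊛ : ∀ u v u⁻¹ v⁻¹ → u ⊛ u⁻¹ ≋ q^ 0 → v ⊛ v⁻¹ ≋ q^ 0 → (u ⊛ v) ⊛ (u⁻¹ ⊛ v⁻¹) ≋ q^ 0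
  units-⊛ u v u⁻¹ v⁻¹ uu⁻¹≋1 vv⁻¹≋1 = linear-combination
    (solve 4 (λ u v u⁻¹ v⁻¹ → u :* v :* (u⁻¹ :* v⁻¹) :- con 1ℤ
                             := v :* v⁻¹ :* (u :* u⁻¹ :- con 1ℤ) :+ (v :* v⁻¹ :- con 1ℤ))
       ≋-refl u v u⁻¹ v⁻¹)
    ((v ⊛ v⁻¹) ·ᵛ vanishes uu⁻¹≋1 +ᵛ vanishes vv⁻¹≋1)

  ⊖≋⇒≋⊕ : ∀ f g h → f ⊖ g ≋ h → f ≋ g ⊕ h
  ⊖≋⇒≋⊕ f g h f-g≋h =
    linear-combination (solve 3 (λ f g h → f :- (g :+ h) := f :- g :- h) ≋-refl f g h) (vanishes f-g≋h)

  ⊖≋⇒≋⊖ : ∀ f g h → f ⊖ g ≋ h → g ≋ f ⊖ h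
  ⊖≋⇒≋⊖ f g h f-g≋h =
    linear-combination (solve 3 (λ f g h → g :- (f :- h) := h :- (f :- g)) ≋-refl f g h) (vanishes (≋-sym f-g≋h))

  isolate : ∀ f g h w → f ⊕ g ≋ w ⊛ f ⊕ h → (1- w) ⊛ f ≋ h ⊖ g
  isolate f g h w f+g≋wf+h = linear-combination
    (solve 4 (λ f g h w → :1- w :* f :- (h :- g) := f :+ g :- (w :* f :+ h)) ≋-refl f g h w) (vanishes f+g≋wf+h)

  isolate₀ : ∀ f h w → f ≋ w ⊛ f ⊕ h → (1- w) ⊛ f ≋ h
  isolate₀ f h w f≋wf+h = linear-combination
    (solve 3 (λ f h w → :1- w :* f :- h := f :- (w :* f :+ h)) ≋-refl f h w) (vanishes f≋wf+h)

  divide : ∀ u₁ u₃ u₄ u₅ u₆ I₁ I₃ I₄ I₅ I₆ a b p x y₀ y₁ y₂ →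
    u₁ ⊛ I₁ ≋ q^ 0 → u₃ ⊛ I₃ ≋ q^ 0 → u₄ ⊛ I₄ ≋ q^ 0 → u₅ ⊛ I₅ ≋ q^ 0 → u₆ ⊛ I₆ ≋ q^ 0 →
    u₁ ⊛ u₃ ⊛ u₄ ⊛ u₅ ⊛ u₆ ⊛ x ≋ u₁ ⊛ u₃ ⊛ u₄ ⊛ a ⊛ y₂ ⊖ u₁ ⊛ b ⊛ y₁ ⊖ p ⊛ y₀ →
    x ≋ a ⊛ I₅ ⊛ I₆ ⊛ y₂ ⊖ b ⊛ I₃ ⊛ I₄ ⊛ I₅ ⊛ I₆ ⊛ y₁ ⊖ p ⊛ I₁ ⊛ I₃ ⊛ I₄ ⊛ I₅ ⊛ I₆ ⊛ y₀
  divide u₁ u₃ u₄ u₅ u₆ I₁ I₃ I₄ I₅ I₆ a b p x y₀ y₁ y₂ E₁ E₃ E₄ E₅ E₆ h =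
    ≋-trans (divide-by (u₅ ⊛ u₆) (I₅ ⊛ I₆) x _ (units-⊛ u₅ u₆ I₅ I₆ E₅ E₆) step₃) expand
    where
    step₁ : u₃ ⊛ u₄ ⊛ (a ⊛ y₂ ⊖ u₅ ⊛ u₆ ⊛ x) ⊖ b ⊛ y₁ ≋ I₁ ⊛ (p ⊛ y₀)
    step₁ = divide-by u₁ I₁ _ (p ⊛ y₀) E₁ (linear-combination
      (solve 12 (λ u₁ u₃ u₄ u₅ u₆ a b p x y₀ y₁ y₂ →
         u₁ :* (u₃ :* u₄ :* (a :* y₂ :- u₅ :* u₆ :* x) :- b :* y₁) :- p :* y₀
         := u₁ :* u₃ :* u₄ :* a :* y₂ :- u₁ :* b :* y₁ :- p :* y₀ :- u₁ :* u₃ :* u₄ :* u₅ :* u₆ :* x)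
         ≋-refl u₁ u₃ u₄ u₅ u₆ a b p x y₀ y₁ y₂)
      (vanishes (≋-sym h)))
    step₂ : a ⊛ y₂ ⊖ u₅ ⊛ u₆ ⊛ x ≋ I₃ ⊛ I₄ ⊛ (b ⊛ y₁ ⊕ I₁ ⊛ (p ⊛ y₀))
    step₂ = divide-by (u₃ ⊛ u₄) (I₃ ⊛ I₄) _ _ (units-⊛ u₃ u₄ I₃ I₄ E₃ E₄) (⊖≋⇒≋⊕ _ (b ⊛ y₁) _ step₁)
    step₃ : u₅ ⊛ u₆ ⊛ x ≋ a ⊛ y₂ ⊖ I₃ ⊛ I₄ ⊛ (b ⊛ y₁ ⊕ I₁ ⊛ (p ⊛ y₀))
    step₃ = ⊖≋⇒≋⊖ (a ⊛ y₂) (u₅ ⊛ u₆ ⊛ x) _ step₂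
    expand : I₅ ⊛ I₆ ⊛ (a ⊛ y₂ ⊖ I₃ ⊛ I₄ ⊛ (b ⊛ y₁ ⊕ I₁ ⊛ (p ⊛ y₀)))
           ≋ a ⊛ I₅ ⊛ I₆ ⊛ y₂ ⊖ b ⊛ I₃ ⊛ I₄ ⊛ I₅ ⊛ I₆ ⊛ y₁ ⊖ p ⊛ I₁ ⊛ I₃ ⊛ I₄ ⊛ I₅ ⊛ I₆ ⊛ y₀
    expand = solve 11 (λ I₁ I₃ I₄ I₅ I₆ a b p y₀ y₁ y₂ →
      I₅ :* I₆ :* (a :* y₂ :- I₃ :* I₄ :* (b :* y₁ :+ I₁ :* (p :* y₀)))
      := a :* I₅ :* I₆ :* y₂ :- b :* I₃ :* I₄ :* I₅ :* I₆ :* y₁ :- p :* I₁ :* I₃ :* I₄ :* I₅ :* I₆ :* y₀)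
      ≋-refl I₁ I₃ I₄ I₅ I₆ a b p y₀ y₁ y₂

open SeriesRing

module Counting where

  open import Data.Empty using (⊥-elim)
  open import Data.List using (List; []; _∷_; map; filter; length)
  open import Data.List.Properties using (length-map; map-∘; map-id-local; filter-none)
  open import Data.List.Membership.Propositional using (_∈_)
  open import Data.List.Membership.Propositional.Properties using (∈-map⁺; ∈-map⁻; ∈-filter⁺; ∈-filter⁻)
  open import Data.List.Membership.Propositional.Properties.WithK using (unique∧set⇒bag)
  open import Data.List.Relation.Binary.BagAndSetEquality using (∼bag⇒↭)
  open import Data.List.Relation.Binary.Permutation.Propositional.Properties using (↭-length)
  open import Data.List.Relation.Unary.All as All using (All)
  open import Data.List.Relation.Unary.Any using (here; there)
  open import Data.List.Relation.Unary.Unique.Propositional using (Unique)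
  import Data.List.Relation.Unary.Unique.Propositional.Properties as Unique
  open import Data.Nat using (ℕ; suc; _+_)
  open import Data.Nat.Properties using (+-suc)
  open import Data.Product using (_×_; _,_)
  open import Function using (_∘_)
  open import Function.Bundles using (mk⇔)
  open import Level using (0ℓ)
  open import Relation.Binary.PropositionalEquality
  open import Relation.Nullary using (¬_; yes; no)
  open import Relation.Unary using (Pred; Decidable)
  open import Relation.Unary.Properties using (_∩?_; _∪?_; ∁?)

  private
    variable
      A B : Set

  count : {P : Pred A 0ℓ} → Decidable P → List A → ℕ
  count P? xs = length (filter P? xs)

  count-cong : {P Q : Pred A 0ℓ} (P? : Decidable P) (Q? : Decidable Q) (xs : List A) →
    (∀ {x} → x ∈ xs → P x → Q x) → (∀ {x} → x ∈ xs → Q x → P x) → count P? xs ≡ count Q? xs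
  count-cong P? Q? []       P⇒Q Q⇒P = refl
  count-cong P? Q? (x ∷ xs) P⇒Q Q⇒P with P? x | Q? x
  ... | yes _  | yes _  = cong suc (count-cong P? Q? xs (P⇒Q ∘ there) (Q⇒P ∘ there))
  ... | no _   | no _   = count-cong P? Q? xs (P⇒Q ∘ there) (Q⇒P ∘ there)
  ... | yes px | no ¬qx = ⊥-elim (¬qx (P⇒Q (here refl) px))
  ... | no ¬px | yes qx = ⊥-elim (¬px (Q⇒P (here refl) qx))

  count-split : {P R : Pred A 0ℓ} (P? : Decidable P) (R? : Decidable R) (xs : List A) →
    count P? xs ≡ count (P? ∩? R?) xs + count (P? ∩? ∁? R?) xs
  count-split P? R? [] = refl
  count-split P? R? (x ∷ xs) with P? x | R? x
  ... | yes _ | yes _ = cong suc (count-split P? R? xs)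
  ... | yes _ | no _  = trans (cong suc (count-split P? R? xs)) (sym (+-suc _ _))
  ... | no _  | _     = count-split P? R? xs

  count-∪ : {P Q R : Pred A 0ℓ} (P? : Decidable P) (Q? : Decidable Q) (R? : Decidable R) (xs : List A) →
    count (P? ∩? (Q? ∪? R?)) xs + count (P? ∩? (Q? ∩? R?)) xs ≡ count (P? ∩? Q?) xs + count (P? ∩? R?) xs
  count-∪ P? Q? R? [] = refl
  count-∪ P? Q? R? (x ∷ xs) with P? x | Q? x | R? x
  ... | no _  | _     | _     = count-∪ P? Q? R? xs
  ... | yes _ | yes _ | yes _ = cong suc (trans (+-suc _ _) (trans (cong suc (count-∪ P? Q? R? xs)) (sym (+-suc _ _))))
  ... | yes _ | yes _ | no _  = cong suc (count-∪ P? Q? R? xs)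
  ... | yes _ | no _  | yes _ = trans (cong suc (count-∪ P? Q? R? xs)) (sym (+-suc _ _))
  ... | yes _ | no _  | no _  = count-∪ P? Q? R? xs

  count-none : {P : Pred A 0ℓ} (P? : Decidable P) (xs : List A) → (∀ {x} → x ∈ xs → ¬ P x) → count P? xs ≡ 0
  count-none P? xs ¬P = cong length (filter-none P? (All.tabulate ¬P))

  count-bijection : {P : Pred A 0ℓ} {Q : Pred B 0ℓ} (P? : Decidable P) (Q? : Decidable Q)
    {xs : List A} {ys : List B} → Unique xs → Unique ys → (f : A → B) (g : B → A) →
    (∀ {x} → x ∈ xs → P x → f x ∈ ys × Q (f x)) →
    (∀ {y} → y ∈ ys → Q y → g y ∈ xs × P (g y)) →
    (∀ {x} → x ∈ xs → P x → g (f x) ≡ x) →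
    (∀ {y} → y ∈ ys → Q y → f (g y) ≡ y) →
    count P? xs ≡ count Q? ys
  count-bijection P? Q? {xs} {ys} xs! ys! f g f∈ g∈ gf fg =
    trans (sym (length-map f (filter P? xs)))
      (↭-length (∼bag⇒↭ (unique∧set⇒bag f[xs]! (Unique.filter⁺ Q? ys!) (mk⇔ to from))))
    where
    -- map f (filter P? xs) and filter Q? ys are duplicate-free with the same
    -- elements, hence permutations of each other.
    g∘f≡id : map g (map f (filter P? xs)) ≡ filter P? xs
    g∘f≡id = trans (sym (map-∘ (filter P? xs)))
      (map-id-local (All.tabulate λ x∈ → let (x∈xs , Px) = ∈-filter⁻ P? x∈ in gf x∈xs Px))
    f[xs]! : Unique (map f (filter P? xs))
    f[xs]! = Unique.map⁻ (subst Unique (sym g∘f≡id) (Unique.filter⁺ P? xs!))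
    to : ∀ {y} → y ∈ map f (filter P? xs) → y ∈ filter Q? ys
    to y∈ with x , x∈ , refl ← ∈-map⁻ f y∈ =
      let (x∈xs , Px) = ∈-filter⁻ P? x∈ ; (fx∈ys , Qfx) = f∈ x∈xs Px in ∈-filter⁺ Q? fx∈ys Qfx
    from : ∀ {y} → y ∈ filter Q? ys → y ∈ map f (filter P? xs)
    from y∈ = let (y∈ys , Qy) = ∈-filter⁻ Q? y∈ ; (gy∈xs , Pgy) = g∈ y∈ys Qy in
      subst (_∈ map f (filter P? xs)) (fg y∈ys Qy) (∈-map⁺ f (∈-filter⁺ P? gy∈xs Pgy))

module CylindricPairs where

  open Counting
  open import Data.Empty using (⊥-elim)
  open import Data.List using (List; []; _∷_; [_]; _++_; map; take; length; upTo; cartesianProduct)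
  open import Data.List.Properties using (length-map; length-take; length-++)
  open import Data.List.Membership.Propositional using (_∈_)
  open import Data.List.Membership.Propositional.Properties
    using (∈-map⁺; ∈-map⁻; ∈-concat⁺′; ∈-concat⁻′; ∈-upTo⁺; ∈-upTo⁻; ∈-cartesianProduct⁺; ∈-cartesianProduct⁻)
  open import Data.List.Relation.Unary.All as All using (All; []; _∷_; all?)
  import Data.List.Relation.Unary.All.Properties as All
  open import Data.List.Relation.Unary.Any using (here)
  import Data.List.Relation.Unary.AllPairs as AllPairs
  import Data.List.Relation.Unary.AllPairs.Properties as AllPairs
  open import Data.List.Relation.Unary.Unique.Propositional using (Unique)
  import Data.List.Relation.Unary.Unique.Propositional.Properties as Unique
  open import Data.Nat as ℕ using (ℕ; zero; suc; pred; _+_; _≤_; _<_; z≤n; s≤s; _≟_)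
  import Data.Nat.Properties as ℕ
  open import Data.Nat.ListAction using (sum)
  open import Data.Nat.ListAction.Properties using (sum-++)
  open import Data.Product using (_×_; _,_; proj₁; proj₂)
  open import Data.Sum using (inj₁; inj₂)
  open import Function using (_∘_)
  open import Function.Bundles using (_⇔_; mk⇔; Equivalence)
  open import Level using (0ℓ)
  open import Relation.Binary.PropositionalEquality hiding ([_])
  open import Relation.Nullary using (¬_; yes; no)
  open import Relation.Nullary.Decidable using (_×-dec_; map′; decidable-stable)
  open import Relation.Unary using (Pred; Decidable; _∩_; _∪_; ∁)
  open import Relation.Unary.Properties using (_∩?_; _∪?_; ∁?)
  open import Data.Nat.Solver using (module +-*-Solver)
  open +-*-Solver using (solve; _:+_; _:=_)

  at-≥ : ∀ (l : List ℕ) {j} → length l ≤ j → at l j ≡ 0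
  at-≥ []      _       = refl
  at-≥ (x ∷ l) (s≤s p) = at-≥ l p

  at-pad : ∀ (l : List ℕ) j → at (l ++ [ 0 ]) j ≡ at l j
  at-pad []      zero    = refl
  at-pad []      (suc j) = refl
  at-pad (x ∷ l) zero    = refl
  at-pad (x ∷ l) (suc j) = at-pad l j

  sum-pad : ∀ (l : List ℕ) → sum (l ++ [ 0 ]) ≡ sum l
  sum-pad l = trans (sum-++ l [ 0 ]) (ℕ.+-identityʳ (sum l))

  length-pad : ∀ (l : List ℕ) → length (l ++ [ 0 ]) ≡ suc (length l)
  length-pad l = trans (length-++ l) (ℕ.+-comm (length l) 1)

  pad-take : ∀ (l : List ℕ) r → length l ≡ suc r → at l r ≡ 0 → take r l ++ [ 0 ] ≡ l
  pad-take (x ∷ [])    zero    _ x≡0 = cong [_] (sym x≡0)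
  pad-take (x ∷ y ∷ l) (suc r) ∣l∣ l[r]≡0 =
    cong (x ∷_) (pad-take (y ∷ l) r (ℕ.suc-injective ∣l∣) l[r]≡0)

  length-take-suc : ∀ (l : List ℕ) r → length l ≡ suc r → length (take r l) ≡ r
  length-take-suc l r ∣l∣ = trans (length-take r l) (trans (cong (r ℕ.⊓_) ∣l∣) (ℕ.m≤n⇒m⊓n≡m (ℕ.n≤1+n r)))

  vecs-unique : ∀ n m → Unique (vecs n m)
  vecs-unique zero    m = AllPairs._∷_ [] AllPairs.[]
  vecs-unique (suc n) m =
    Unique.concat⁺ (All.map⁺ (All.tabulate λ _ → Unique.map⁺ (λ { refl → refl }) (vecs-unique n m)))
      (AllPairs.map⁺ (AllPairs.map disjoint (Unique.upTo⁺ (suc m))))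
    where
    disjoint : ∀ {x y} → x ≢ y → ∀ {v} → ¬ (v ∈ map (x ∷_) (vecs n m) × v ∈ map (y ∷_) (vecs n m))
    disjoint x≢y (v∈ , v∈′) with _ , _ , refl ← ∈-map⁻ _ v∈ | _ , _ , refl ← ∈-map⁻ _ v∈′ = x≢y refl

  ∈-vecs⁺ : ∀ {n m} (v : List ℕ) → length v ≡ n → All (_≤ m) v → v ∈ vecs n m
  ∈-vecs⁺ {zero}      []      refl []         = here refl
  ∈-vecs⁺ {suc n} {m} (x ∷ v) refl (x≤m ∷ v≤m) =
    ∈-concat⁺′ (∈-map⁺ (x ∷_) (∈-vecs⁺ v refl v≤m))
               (∈-map⁺ (λ x → map (x ∷_) (vecs n m)) (∈-upTo⁺ (s≤s x≤m)))

  ∈-vecs⁻ : ∀ {n m} (v : List ℕ) → v ∈ vecs n m → length v ≡ n × All (_≤ m) v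
  ∈-vecs⁻ {zero}      []      (here refl) = refl , []
  ∈-vecs⁻ {suc n} {m} v       v∈
    with vs , v∈vs , vs∈ ← ∈-concat⁻′ (map (λ x → map (x ∷_) (vecs n m)) (upTo (suc m))) v∈
    with x , x∈ , refl ← ∈-map⁻ _ vs∈
    with w , w∈ , refl ← ∈-map⁻ _ v∈vs
    = let (∣w∣ , w≤m) = ∈-vecs⁻ w w∈ in cong suc ∣w∣ , ℕ.s≤s⁻¹ (∈-upTo⁻ x∈) ∷ w≤m

  Pair : Set
  Pair = List ℕ × List ℕ

  -- a = λ⁽¹⁾ and b = λ⁽²⁾, indexed from 0; b≤a and a≤b are the profile conditions
  -- λ⁽¹⁾_j ≥ λ⁽²⁾_(j+1) and λ⁽²⁾_j ≥ λ⁽¹⁾_(j+3).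
  record IsCylindric (m : ℕ) (a b : List ℕ) : Set where
    field
      a-decreasing : ∀ j → at a (suc j) ≤ at a j
      b-decreasing : ∀ j → at b (suc j) ≤ at b j
      b≤a          : ∀ j → at b (suc j) ≤ at a j
      a≤b          : ∀ j → at a (3 + j) ≤ at b j
      size         : sum a + sum b ≡ m
  open IsCylindric

  Cylindric : ℕ → Pred Pair 0ℓ
  Cylindric m (a , b) = IsCylindric m a b

  ∀-from-upTo : ∀ {φ : ℕ → Set} K → All φ (upTo K) → (∀ {j} → K ≤ j → φ j) → ∀ j → φ j
  ∀-from-upTo K φ<K φ≥K j with j ℕ.<? K
  ... | yes j<K = All.applyUpTo⁻ (λ i → i) K φ<K j<K
  ... | no  j≮K = φ≥K (ℕ.≮⇒≥ j≮K)

  fromIsCP31 : ∀ {K m} (a b : List ℕ) → length a ≤ K → length b ≤ K → IsCP31 K m (a , b) → IsCylindric m a b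
  fromIsCP31 {K} a b ∣a∣≤K ∣b∣≤K (a↓ , b↓ , (b≤a′ , a≤b′) , ∣ab∣) = record
    { a-decreasing = ∀-from-upTo K a↓ λ K≤j → ≤0 (at-≥ a (ℕ.m≤n⇒m≤1+n (ℕ.≤-trans ∣a∣≤K K≤j)))
    ; b-decreasing = ∀-from-upTo K b↓ λ K≤j → ≤0 (at-≥ b (ℕ.m≤n⇒m≤1+n (ℕ.≤-trans ∣b∣≤K K≤j)))
    ; b≤a = λ j → subst (λ i → at b i ≤ at a j) (ℕ.+-comm j 1)
        (∀-from-upTo K b≤a′ (λ {j} K≤j → ≤0 (at-≥ b (ℕ.≤-trans ∣b∣≤K (ℕ.≤-trans K≤j (ℕ.m≤m+n j 1))))) j)
    ; a≤b = λ j → subst (λ i → at a i ≤ at b j) (ℕ.+-comm j 3)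
        (∀-from-upTo K a≤b′ (λ {j} K≤j → ≤0 (at-≥ a (ℕ.≤-trans ∣a∣≤K (ℕ.≤-trans K≤j (ℕ.m≤m+n j 3))))) j)
    ; size = ∣ab∣ }
    where
    ≤0 : ∀ {x y} → x ≡ 0 → x ≤ y
    ≤0 refl = z≤n

  toIsCP31 : ∀ K {m} {a b : List ℕ} → IsCylindric m a b → IsCP31 K m (a , b)
  toIsCP31 K {a = a} {b} c =
    All.applyUpTo⁺₂ (λ i → i) K (a-decreasing c) ,
    All.applyUpTo⁺₂ (λ i → i) K (b-decreasing c) ,
    (All.applyUpTo⁺₂ (λ i → i) K (λ j → subst (λ i → at b i ≤ at a j) (ℕ.+-comm 1 j) (b≤a c j)) ,
     All.applyUpTo⁺₂ (λ i → i) K (λ j → subst (λ i → at a i ≤ at b j) (ℕ.+-comm 3 j) (a≤b c j))) ,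
    size c

  cylindric? : ∀ m → Decidable (Cylindric m)
  cylindric? m (a , b) = map′ (fromIsCP31 a b (ℕ.m≤m+n _ _) (ℕ.m≤n+m _ _)) (toIsCP31 _)
    (isCP31? (length a + length b) m (a , b))

  -- Partitions with at most r and s parts, as lists of exactly r and s entries;
  -- no part of a pair of size m exceeds m.
  Pairs : ℕ → ℕ → ℕ → List Pair
  Pairs r s m = cartesianProduct (vecs r m) (vecs s m)

  Pairs-unique : ∀ r s m → Unique (Pairs r s m)
  Pairs-unique r s m = Unique.cartesianProduct⁺ (vecs-unique r m) (vecs-unique s m)

  ∈-Pairs⁻ : ∀ {r s m} {a b : List ℕ} → (a , b) ∈ Pairs r s m → length a ≡ r × length b ≡ s
  ∈-Pairs⁻ {r} {s} {m} {a} {b} ab∈ = let (a∈ , b∈) = ∈-cartesianProduct⁻ (vecs r m) (vecs s m) ab∈ in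
    proj₁ (∈-vecs⁻ a a∈) , proj₁ (∈-vecs⁻ b b∈)

  cpCount : ℕ → ℕ → ℕ → ℕ
  cpCount r s m = count (cylindric? m) (Pairs r s m)

  cp31count≡cpCount : ∀ n m → cp31count n m ≡ cpCount n n m
  cp31count≡cpCount n m = count-cong (isCP31? n m) (cylindric? m) (Pairs n n m)
    (λ { {a , b} ab∈ → let (∣a∣ , ∣b∣) = ∈-Pairs⁻ ab∈ in
           fromIsCP31 a b (ℕ.≤-reflexive ∣a∣) (ℕ.≤-reflexive ∣b∣) })
    (λ _ → toIsCP31 n)

  Positive : Pred Pair 0ℓ
  Positive (a , b) = All (0 <_) a × All (0 <_) b

  positive? : Decidable Positive
  positive? (a , b) = all? (0 ℕ.<?_) a ×-dec all? (0 ℕ.<?_) b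

  positiveCount : ℕ → ℕ → ℕ → ℕ
  positiveCount r s m = count (cylindric? m ∩? positive?) (Pairs r s m)

  at-map-pred : ∀ (l : List ℕ) j → at (map pred l) j ≡ pred (at l j)
  at-map-pred []      j       = refl
  at-map-pred (x ∷ l) zero    = refl
  at-map-pred (x ∷ l) (suc j) = at-map-pred l j

  at-map-suc : ∀ (l : List ℕ) {j} → j < length l → at (map suc l) j ≡ suc (at l j)
  at-map-suc (x ∷ l) {zero}  _       = refl
  at-map-suc (x ∷ l) {suc j} (s≤s p) = at-map-suc l p

  at-map-suc-mono : ∀ (l′ l : List ℕ) {j′ j} → (j′ < length l′ → j < length l) → at l′ j′ ≤ at l j →
    at (map suc l′) j′ ≤ at (map suc l) j
  at-map-suc-mono l′ l {j′} {j} inside ≤ with j′ ℕ.<? length l′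
  ... | yes j′< = subst₂ _≤_ (sym (at-map-suc l′ j′<)) (sym (at-map-suc l (inside j′<))) (s≤s ≤)
  ... | no  j′≮ = subst (_≤ at (map suc l) j)
    (sym (at-≥ (map suc l′) (subst (_≤ j′) (sym (length-map suc l′)) (ℕ.≮⇒≥ j′≮)))) z≤n

  sum-map-suc : ∀ (l : List ℕ) → sum (map suc l) ≡ sum l + length l
  sum-map-suc []      = refl
  sum-map-suc (x ∷ l) = trans (cong suc (trans (cong (x +_) (sum-map-suc l)) (sym (ℕ.+-assoc x (sum l) (length l)))))
    (sym (ℕ.+-suc (x + sum l) (length l)))

  sum-map-pred : ∀ {l : List ℕ} → All (0 <_) l → sum (map pred l) + length l ≡ sum l
  sum-map-pred []                   = refl
  sum-map-pred {suc x ∷ l} (_ ∷ l>0) = trans (ℕ.+-suc (x + sum (map pred l)) (length l))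
    (cong suc (trans (ℕ.+-assoc x _ _) (cong (x +_) (sum-map-pred l>0))))

  map-suc-pred : ∀ {l : List ℕ} → All (0 <_) l → map suc (map pred l) ≡ l
  map-suc-pred []                    = refl
  map-suc-pred {suc x ∷ l} (_ ∷ l>0) = cong (suc x ∷_) (map-suc-pred l>0)

  map-pred-suc : ∀ (l : List ℕ) → map pred (map suc l) ≡ l
  map-pred-suc []      = refl
  map-pred-suc (x ∷ l) = cong (x ∷_) (map-pred-suc l)

  all-map-suc : ∀ (l : List ℕ) → All (0 <_) (map suc l)
  all-map-suc l = All.map⁺ (All.universal (λ _ → s≤s z≤n) l)

  length≤sum : ∀ {l : List ℕ} → All (0 <_) l → length l ≤ sum l
  length≤sum []                    = z≤n
  length≤sum {suc x ∷ l} (_ ∷ l>0) = s≤s (ℕ.≤-trans (length≤sum l>0) (ℕ.m≤n+m (sum l) x))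

  parts≤sum : ∀ (l : List ℕ) → All (_≤ sum l) l
  parts≤sum []      = []
  parts≤sum (x ∷ l) = ℕ.m≤m+n x (sum l) ∷ All.map (λ p → ℕ.≤-trans p (ℕ.m≤n+m (sum l) x)) (parts≤sum l)

  ∈-Pairs⁺ : ∀ {r s m} {a b : List ℕ} → length a ≡ r → length b ≡ s → IsCylindric m a b → (a , b) ∈ Pairs r s m
  ∈-Pairs⁺ {a = a} {b} ∣a∣ ∣b∣ c = ∈-cartesianProduct⁺
    (∈-vecs⁺ a ∣a∣ (All.map (λ p → ℕ.≤-trans p (subst (sum a ≤_) (size c) (ℕ.m≤m+n _ _))) (parts≤sum a)))
    (∈-vecs⁺ b ∣b∣ (All.map (λ p → ℕ.≤-trans p (subst (sum b ≤_) (size c) (ℕ.m≤n+m _ _))) (parts≤sum b)))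

  lower-cylindric : ∀ {r s m} {a b : List ℕ} → length a ≡ r → length b ≡ s →
    IsCylindric (r + s + m) a b → Positive (a , b) → IsCylindric m (map pred a) (map pred b)
  lower-cylindric {r} {s} {m} {a} {b} ∣a∣ ∣b∣ c (a>0 , b>0) = record
    { a-decreasing = λ j → lower a a (a-decreasing c j)
    ; b-decreasing = λ j → lower b b (b-decreasing c j)
    ; b≤a          = λ j → lower b a (b≤a c j)
    ; a≤b          = λ j → lower a b (a≤b c j)
    ; size         = ℕ.+-cancelˡ-≡ (r + s) _ _ (begin
        r + s + (sum (map pred a) + sum (map pred b))
          ≡⟨ solve 4 (λ r s x y → r :+ s :+ (x :+ y) := (x :+ r) :+ (y :+ s)) refl r s (sum (map pred a)) (sum (map pred b)) ⟩
        (sum (map pred a) + r) + (sum (map pred b) + s)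
          ≡⟨ cong₂ _+_ (subst (λ n → sum (map pred a) + n ≡ sum a) ∣a∣ (sum-map-pred a>0))
                       (subst (λ n → sum (map pred b) + n ≡ sum b) ∣b∣ (sum-map-pred b>0)) ⟩
        sum a + sum b
          ≡⟨ size c ⟩
        r + s + m
          ∎) }
    where
    open ≡-Reasoning
    lower : ∀ (l′ l : List ℕ) {j′ j} → at l′ j′ ≤ at l j → at (map pred l′) j′ ≤ at (map pred l) j
    lower l′ l ≤ = subst₂ _≤_ (sym (at-map-pred l′ _)) (sym (at-map-pred l _)) (ℕ.pred-mono-≤ ≤)

  -- The length conditions are exactly what keeps the interlacing conditions
  -- true at the boundary, where a padding zero faces a part.
  raise-cylindric : ∀ {r s m} {a b : List ℕ} → s ≤ suc r → r ≤ 3 + s → length a ≡ r → length b ≡ s →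
    IsCylindric m a b → IsCylindric (r + s + m) (map suc a) (map suc b)
  raise-cylindric {r} {s} {m} {a} {b} s≤1+r r≤3+s refl refl c = record
    { a-decreasing = λ j → at-map-suc-mono a a (ℕ.<-trans (ℕ.n<1+n j)) (a-decreasing c j)
    ; b-decreasing = λ j → at-map-suc-mono b b (ℕ.<-trans (ℕ.n<1+n j)) (b-decreasing c j)
    ; b≤a          = λ j → at-map-suc-mono b a (λ 1+j<s → ℕ.s≤s⁻¹ (ℕ.≤-trans 1+j<s s≤1+r)) (b≤a c j)
    ; a≤b          = λ j → at-map-suc-mono a b (λ 3+j<r → ℕ.+-cancelˡ-< 3 j s (ℕ.<-≤-trans 3+j<r r≤3+s)) (a≤b c j)
    ; size         = begin
        sum (map suc a) + sum (map suc b)  ≡⟨ cong₂ _+_ (sum-map-suc a) (sum-map-suc b) ⟩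
        (sum a + r) + (sum b + s)          ≡⟨ solve 4 (λ x y r s → (x :+ r) :+ (y :+ s) := r :+ s :+ (x :+ y))
                                                   refl (sum a) (sum b) r s ⟩
        r + s + (sum a + sum b)            ≡⟨ cong (r + s +_) (size c) ⟩
        r + s + m                          ∎ }
    where open ≡-Reasoning

  positiveCount-shift : ∀ r s m → s ≤ suc r → r ≤ 3 + s → positiveCount r s (r + s + m) ≡ cpCount r s m
  positiveCount-shift r s m s≤1+r r≤3+s =
    count-bijection (cylindric? (r + s + m) ∩? positive?) (cylindric? m) (Pairs-unique r s _) (Pairs-unique r s m)
      (λ (a , b) → map pred a , map pred b) (λ (a , b) → map suc a , map suc b)
      (λ { {a , b} ab∈ (c , a,b>0) → let (∣a∣ , ∣b∣) = ∈-Pairs⁻ {r} {s} ab∈ ; c′ = lower-cylindric ∣a∣ ∣b∣ c a,b>0 in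
             ∈-Pairs⁺ (trans (length-map pred a) ∣a∣) (trans (length-map pred b) ∣b∣) c′ , c′ })
      (λ { {a , b} ab∈ c → let (∣a∣ , ∣b∣) = ∈-Pairs⁻ {r} {s} ab∈ ; c′ = raise-cylindric s≤1+r r≤3+s ∣a∣ ∣b∣ c in
             ∈-Pairs⁺ (trans (length-map suc a) ∣a∣) (trans (length-map suc b) ∣b∣) c′ , c′ , all-map-suc a , all-map-suc b })
      (λ { {a , b} _ (_ , a>0 , b>0) → cong₂ _,_ (map-suc-pred a>0) (map-suc-pred b>0) })
      (λ { {a , b} _ _ → cong₂ _,_ (map-pred-suc a) (map-pred-suc b) })

  positiveCount-small : ∀ r s m → m < r + s → positiveCount r s m ≡ 0
  positiveCount-small r s m m<r+s = count-none (cylindric? m ∩? positive?) (Pairs r s m)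
    λ { {a , b} ab∈ (c , a>0 , b>0) → let (∣a∣ , ∣b∣) = ∈-Pairs⁻ {r} {s} {m} ab∈ in
        ℕ.<⇒≱ m<r+s (subst₂ _≤_ (cong₂ _+_ ∣a∣ ∣b∣) (size c) (ℕ.+-mono-≤ (length≤sum a>0) (length≤sum b>0))) }

  -- For decreasing lists: at most r (resp. s) nonzero parts.
  AtMostParts₁ AtMostParts₂ : ℕ → Pred Pair 0ℓ
  AtMostParts₁ r (a , b) = at a r ≡ 0
  AtMostParts₂ s (a , b) = at b s ≡ 0

  atMostParts₁? : ∀ r → Decidable (AtMostParts₁ r)
  atMostParts₁? r (a , b) = at a r ≟ 0

  atMostParts₂? : ∀ s → Decidable (AtMostParts₂ s)
  atMostParts₂? s (a , b) = at b s ≟ 0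

  cylindric-cong : ∀ {m} {a a′ b b′ : List ℕ} → (∀ j → at a′ j ≡ at a j) → (∀ j → at b′ j ≡ at b j) →
    sum a′ ≡ sum a → sum b′ ≡ sum b → IsCylindric m a b → IsCylindric m a′ b′
  cylindric-cong a′≗a b′≗b Σa′ Σb′ c = record
    { a-decreasing = λ j → subst₂ _≤_ (sym (a′≗a (suc j))) (sym (a′≗a j)) (a-decreasing c j)
    ; b-decreasing = λ j → subst₂ _≤_ (sym (b′≗b (suc j))) (sym (b′≗b j)) (b-decreasing c j)
    ; b≤a          = λ j → subst₂ _≤_ (sym (b′≗b (suc j))) (sym (a′≗a j)) (b≤a c j)
    ; a≤b          = λ j → subst₂ _≤_ (sym (a′≗a (3 + j))) (sym (b′≗b j)) (a≤b c j)
    ; size         = trans (cong₂ _+_ Σa′ Σb′) (size c) }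

  cylindric-pad₁ : ∀ {m} {a b : List ℕ} → IsCylindric m a b ⇔ IsCylindric m (a ++ [ 0 ]) b
  cylindric-pad₁ {a = a} = mk⇔
    (cylindric-cong (at-pad a) (λ _ → refl) (sum-pad a) refl)
    (cylindric-cong (sym ∘ at-pad a) (λ _ → refl) (sym (sum-pad a)) refl)

  cylindric-pad₂ : ∀ {m} {a b : List ℕ} → IsCylindric m a b ⇔ IsCylindric m a (b ++ [ 0 ])
  cylindric-pad₂ {b = b} = mk⇔
    (cylindric-cong (λ _ → refl) (at-pad b) refl (sum-pad b))
    (cylindric-cong (λ _ → refl) (sym ∘ at-pad b) refl (sym (sum-pad b)))

  ∈-vecs-take : ∀ {r m} {v : List ℕ} → v ∈ vecs (suc r) m → take r v ∈ vecs r m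
  ∈-vecs-take {r} {m} {v} v∈ = let (∣v∣ , v≤m) = ∈-vecs⁻ {suc r} {m} v v∈ in
    ∈-vecs⁺ (take r v) (length-take-suc v r ∣v∣) (All.take⁺ r v≤m)

  ∈-vecs-pad : ∀ {r m} {v : List ℕ} → v ∈ vecs r m → v ++ [ 0 ] ∈ vecs (suc r) m
  ∈-vecs-pad {r} {m} {v} v∈ = let (∣v∣ , v≤m) = ∈-vecs⁻ {r} {m} v v∈ in
    ∈-vecs⁺ (v ++ [ 0 ]) (trans (length-pad v) (cong suc ∣v∣)) (All.++⁺ v≤m (z≤n ∷ []))

  at-pad-last : ∀ {r} (v : List ℕ) → length v ≡ r → at (v ++ [ 0 ]) r ≡ 0
  at-pad-last v refl = trans (at-pad v _) (at-≥ v ℕ.≤-refl)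

  take-pad : ∀ {r} (l : List ℕ) → length l ≡ r → take r (l ++ [ 0 ]) ≡ l
  take-pad []      refl = refl
  take-pad (x ∷ l) refl = cong (x ∷_) (take-pad l refl)

  drop-zero₁ : ∀ {Q : Pred Pair 0ℓ} (Q? : Decidable Q) → (∀ {a b} → Q (a , b) → Q (a ++ [ 0 ] , b)) →
    (∀ {a b} → Q (a ++ [ 0 ] , b) → Q (a , b)) →
    ∀ r s m → count (Q? ∩? atMostParts₁? r) (Pairs (suc r) s m) ≡ count Q? (Pairs r s m)
  drop-zero₁ {Q} Q? pad unpad r s m = count-bijection _ Q? (Pairs-unique (suc r) s m) (Pairs-unique r s m)
    (λ (a , b) → take r a , b) (λ (a , b) → a ++ [ 0 ] , b)
    (λ { {a , b} ab∈ (q , a[r]≡0) → let (a∈ , b∈) = ∈-cartesianProduct⁻ (vecs (suc r) m) (vecs s m) ab∈ in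
           ∈-cartesianProduct⁺ (∈-vecs-take {r} {m} a∈) b∈ ,
           unpad (subst (λ a → Q (a , b)) (sym (restore ab∈ a[r]≡0)) q) })
    (λ { {a , b} ab∈ q → let (a∈ , b∈) = ∈-cartesianProduct⁻ (vecs r m) (vecs s m) ab∈ in
           ∈-cartesianProduct⁺ (∈-vecs-pad {r} {m} a∈) b∈ ,
           pad q , at-pad-last a (proj₁ (∈-Pairs⁻ {r} {s} {m} ab∈)) })
    (λ { ab∈ (_ , a[r]≡0) → cong (_, _) (restore ab∈ a[r]≡0) })
    (λ { {a , b} ab∈ _ → cong (_, b) (take-pad a (proj₁ (∈-Pairs⁻ {r} {s} {m} ab∈))) })
    where
    restore : ∀ {a b : List ℕ} → (a , b) ∈ Pairs (suc r) s m → at a r ≡ 0 → take r a ++ [ 0 ] ≡ a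
    restore {a} ab∈ = pad-take a r (proj₁ (∈-Pairs⁻ {suc r} {s} {m} ab∈))

  drop-zero₂ : ∀ r s m → count (cylindric? m ∩? atMostParts₂? s) (Pairs r (suc s) m) ≡ cpCount r s m
  drop-zero₂ r s m = count-bijection _ (cylindric? m) (Pairs-unique r (suc s) m) (Pairs-unique r s m)
    (λ (a , b) → a , take s b) (λ (a , b) → a , b ++ [ 0 ])
    (λ { {a , b} ab∈ (c , b[s]≡0) → let (a∈ , b∈) = ∈-cartesianProduct⁻ (vecs r m) (vecs (suc s) m) ab∈ in
           ∈-cartesianProduct⁺ a∈ (∈-vecs-take {s} {m} b∈) ,
           Equivalence.from cylindric-pad₂ (subst (IsCylindric m a) (sym (restore ab∈ b[s]≡0)) c) })
    (λ { {a , b} ab∈ c → let (a∈ , b∈) = ∈-cartesianProduct⁻ (vecs r m) (vecs s m) ab∈ in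
           ∈-cartesianProduct⁺ a∈ (∈-vecs-pad {s} {m} b∈) ,
           Equivalence.to cylindric-pad₂ c , at-pad-last b (proj₂ (∈-Pairs⁻ {r} {s} {m} ab∈)) })
    (λ { ab∈ (_ , b[s]≡0) → cong (_ ,_) (restore ab∈ b[s]≡0) })
    (λ { {a , b} ab∈ _ → cong (a ,_) (take-pad b (proj₂ (∈-Pairs⁻ {r} {s} {m} ab∈))) })
    where
    restore : ∀ {a b : List ℕ} → (a , b) ∈ Pairs r (suc s) m → at b s ≡ 0 → take s b ++ [ 0 ] ≡ b
    restore {b = b} ab∈ = pad-take b s (proj₂ (∈-Pairs⁻ {r} {suc s} {m} ab∈))

  at-antitone : ∀ (l : List ℕ) → (∀ j → at l (suc j) ≤ at l j) → ∀ {i j} → i ≤ j → at l j ≤ at l i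
  at-antitone l l↓ {j = zero}  z≤n   = ℕ.≤-refl
  at-antitone l l↓ {i} {suc j} i≤1+j with ℕ.m≤n⇒m<n∨m≡n i≤1+j
  ... | inj₁ (s≤s i≤j) = ℕ.≤-trans (l↓ j) (at-antitone l l↓ i≤j)
  ... | inj₂ refl      = ℕ.≤-refl

  All-at : ∀ {P : ℕ → Set} (l : List ℕ) → (∀ {j} → j < length l → P (at l j)) → All P l
  All-at []      P-at = []
  All-at (x ∷ l) P-at = P-at (s≤s z≤n) ∷ All-at l (P-at ∘ s≤s)

  all-above : ∀ {x r} (l : List ℕ) → length l ≤ suc r → (∀ j → at l (suc j) ≤ at l j) → x ≤ at l r → All (x ≤_) l
  all-above {x} {r} l ∣l∣≤ l↓ x≤ =
    All-at l λ j< → ℕ.≤-trans x≤ (at-antitone l l↓ (ℕ.s≤s⁻¹ (ℕ.≤-trans j< ∣l∣≤)))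

  last-zero⇒¬positive : ∀ {r} (l : List ℕ) → length l ≡ suc r → at l r ≡ 0 → ¬ All (0 <_) l
  last-zero⇒¬positive {r} l ∣l∣ l[r]≡0 l>0 =
    ℕ.<⇒≢ (lookup-at l l>0 (subst (r <_) (sym ∣l∣) ℕ.≤-refl)) (sym l[r]≡0)
    where
    lookup-at : ∀ (l : List ℕ) → All (0 <_) l → ∀ {j} → j < length l → 0 < at l j
    lookup-at (x ∷ l) (x>0 ∷ _)   {zero}  _       = x>0
    lookup-at (x ∷ l) (_ ∷ l>0)   {suc j} (s≤s p) = lookup-at l l>0 p

  positive-suc-suc : ∀ {m r s} {a b : List ℕ} → length a ≡ suc r → length b ≡ suc s → IsCylindric m a b →
    0 < at a r → 0 < at b s → Positive (a , b)
  positive-suc-suc ∣a∣ ∣b∣ c a[r]>0 b[s]>0 =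
    all-above _ (ℕ.≤-reflexive ∣a∣) (a-decreasing c) a[r]>0 , all-above _ (ℕ.≤-reflexive ∣b∣) (b-decreasing c) b[s]>0

  -- a_j ≥ b_(j+1) ≥ b_r for j < r
  positive-r-sucr : ∀ {m r} {a b : List ℕ} → length a ≡ r → length b ≡ suc r → IsCylindric m a b →
    0 < at b r → Positive (a , b)
  positive-r-sucr {r = r} {a} {b} ∣a∣ ∣b∣ c b[r]>0 =
    All-at a (λ j<∣a∣ → ℕ.≤-trans b[r]>0
      (ℕ.≤-trans (at-antitone b (b-decreasing c) (subst (_ <_) ∣a∣ j<∣a∣)) (b≤a c _))) ,
    all-above b (ℕ.≤-reflexive ∣b∣) (b-decreasing c) b[r]>0

  -- b_j ≥ a_(j+3) ≥ a_(s+2) for j < s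
  positive-3+s-s : ∀ {m s} {a b : List ℕ} → length a ≡ 3 + s → length b ≡ s → IsCylindric m a b →
    0 < at a (2 + s) → Positive (a , b)
  positive-3+s-s {s = s} {a} {b} ∣a∣ ∣b∣ c a[2+s]>0 =
    all-above a (ℕ.≤-reflexive ∣a∣) (a-decreasing c) a[2+s]>0 ,
    All-at b (λ j<∣b∣ → ℕ.≤-trans a[2+s]>0
      (ℕ.≤-trans (at-antitone a (a-decreasing c) (s≤s (s≤s (subst (_ <_) ∣b∣ j<∣b∣)))) (a≤b c _)))

  ≢0⇒>0 : ∀ {x} → x ≢ 0 → 0 < x
  ≢0⇒>0 {zero}  x≢0 = ⊥-elim (x≢0 refl)
  ≢0⇒>0 {suc x} _   = s≤s z≤n

  count-nonpositive : ∀ {m} {Z : Pred Pair 0ℓ} (Z? : Decidable Z) (xs : List Pair) →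
    (∀ {x} → x ∈ xs → Cylindric m x → Z x → ¬ Positive x) →
    (∀ {x} → x ∈ xs → Cylindric m x → ¬ Z x → Positive x) →
    count (cylindric? m ∩? ∁? positive?) xs ≡ count (cylindric? m ∩? Z?) xs
  count-nonpositive Z? xs Z⇒¬positive ¬Z⇒positive = count-cong _ _ xs
    (λ {x} x∈ (c , ¬positive) → c , decidable-stable (Z? x) (λ ¬z → ¬positive (¬Z⇒positive x∈ c ¬z)))
    (λ x∈ (c , z) → c , Z⇒¬positive x∈ c z)

  drop-zero₁-cylindric : ∀ r s m → count (cylindric? m ∩? atMostParts₁? r) (Pairs (suc r) s m) ≡ cpCount r s m
  drop-zero₁-cylindric r s m = drop-zero₁ (cylindric? m) (Equivalence.to cylindric-pad₁) (Equivalence.from cylindric-pad₁) r s m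

  cpCount-suc-suc : ∀ r s m → cpCount (suc r) (suc s) m + cpCount r s m
                            ≡ positiveCount (suc r) (suc s) m + (cpCount r (suc s) m + cpCount (suc r) s m)
  cpCount-suc-suc r s m = begin
    cpCount (suc r) (suc s) m + cpCount r s m
      ≡⟨ cong₂ _+_ (count-split C? positive? Q) (sym both) ⟩
    (P + count (C? ∩? ∁? positive?) Q) + count (C? ∩? (Z₁? ∩? Z₂?)) Q
      ≡⟨ ℕ.+-assoc P _ _ ⟩
    P + (count (C? ∩? ∁? positive?) Q + count (C? ∩? (Z₁? ∩? Z₂?)) Q)
      ≡⟨ cong (λ n → P + (n + count (C? ∩? (Z₁? ∩? Z₂?)) Q)) nonpositive ⟩
    P + (count (C? ∩? (Z₁? ∪? Z₂?)) Q + count (C? ∩? (Z₁? ∩? Z₂?)) Q)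
      ≡⟨ cong (P +_) (count-∪ C? Z₁? Z₂? Q) ⟩
    P + (count (C? ∩? Z₁?) Q + count (C? ∩? Z₂?) Q)
      ≡⟨ cong (P +_) (cong₂ _+_ (drop-zero₁-cylindric r (suc s) m) (drop-zero₂ (suc r) s m)) ⟩
    P + (cpCount r (suc s) m + cpCount (suc r) s m)
      ∎
    where
    open ≡-Reasoning
    C? : Decidable (Cylindric m)
    C? = cylindric? m
    Z₁? : Decidable (AtMostParts₁ r)
    Z₁? = atMostParts₁? r
    Z₂? : Decidable (AtMostParts₂ s)
    Z₂? = atMostParts₂? s
    Q : List Pair
    Q = Pairs (suc r) (suc s) m
    P : ℕ
    P = positiveCount (suc r) (suc s) m
    lengths : ∀ {a b : List ℕ} → (a , b) ∈ Q → length a ≡ suc r × length b ≡ suc s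
    lengths = ∈-Pairs⁻ {suc r} {suc s} {m}
    nonpositive : count (C? ∩? ∁? positive?) Q ≡ count (C? ∩? (Z₁? ∪? Z₂?)) Q
    nonpositive = count-nonpositive (Z₁? ∪? Z₂?) Q
      (λ { {a , b} ab∈ _ (inj₁ z₁) (a>0 , _) → last-zero⇒¬positive a (proj₁ (lengths ab∈)) z₁ a>0
         ; {a , b} ab∈ _ (inj₂ z₂) (_ , b>0) → last-zero⇒¬positive b (proj₂ (lengths ab∈)) z₂ b>0 })
      (λ { {a , b} ab∈ c ¬z → let (∣a∣ , ∣b∣) = lengths ab∈ in
           positive-suc-suc ∣a∣ ∣b∣ c (≢0⇒>0 (¬z ∘ inj₁)) (≢0⇒>0 (¬z ∘ inj₂)) })
    both : count (C? ∩? (Z₁? ∩? Z₂?)) Q ≡ cpCount r s m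
    both = begin
      count (C? ∩? (Z₁? ∩? Z₂?)) Q        ≡⟨ count-cong _ ((C? ∩? Z₂?) ∩? Z₁?) Q (λ _ (c , z₁ , z₂) → (c , z₂) , z₁)
                                                                                 (λ _ ((c , z₂) , z₁) → c , z₁ , z₂) ⟩
      count ((C? ∩? Z₂?) ∩? Z₁?) Q        ≡⟨ drop-zero₁ (C? ∩? Z₂?) (λ (c , z₂) → Equivalence.to cylindric-pad₁ c , z₂)
                                                                   (λ (c , z₂) → Equivalence.from cylindric-pad₁ c , z₂) r (suc s) m ⟩
      count (C? ∩? Z₂?) (Pairs r (suc s) m) ≡⟨ drop-zero₂ r s m ⟩
      cpCount r s m                       ∎

  cpCount-r-sucr : ∀ r m → cpCount r (suc r) m ≡ positiveCount r (suc r) m + cpCount r r m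
  cpCount-r-sucr r m = begin
    cpCount r (suc r) m                                    ≡⟨ count-split (cylindric? m) positive? Q ⟩
    P + count (cylindric? m ∩? ∁? positive?) Q             ≡⟨ cong (P +_) nonpositive ⟩
    P + count (cylindric? m ∩? atMostParts₂? r) Q          ≡⟨ cong (P +_) (drop-zero₂ r r m) ⟩
    P + cpCount r r m                                      ∎
    where
    open ≡-Reasoning
    Q : List Pair
    Q = Pairs r (suc r) m
    P : ℕ
    P = positiveCount r (suc r) m
    lengths : ∀ {a b : List ℕ} → (a , b) ∈ Q → length a ≡ r × length b ≡ suc r
    lengths = ∈-Pairs⁻ {r} {suc r} {m}
    nonpositive : count (cylindric? m ∩? ∁? positive?) Q ≡ count (cylindric? m ∩? atMostParts₂? r) Q
    nonpositive = count-nonpositive (atMostParts₂? r) Q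
      (λ { {a , b} ab∈ _ z (_ , b>0) → last-zero⇒¬positive b (proj₂ (lengths ab∈)) z b>0 })
      (λ { {a , b} ab∈ c ¬z → positive-r-sucr (proj₁ (lengths ab∈)) (proj₂ (lengths ab∈)) c (≢0⇒>0 ¬z) })

  cpCount-3+s-s : ∀ s m → cpCount (3 + s) s m ≡ positiveCount (3 + s) s m + cpCount (2 + s) s m
  cpCount-3+s-s s m = begin
    cpCount (3 + s) s m                                    ≡⟨ count-split (cylindric? m) positive? Q ⟩
    P + count (cylindric? m ∩? ∁? positive?) Q             ≡⟨ cong (P +_) nonpositive ⟩
    P + count (cylindric? m ∩? atMostParts₁? (2 + s)) Q    ≡⟨ cong (P +_) (drop-zero₁-cylindric (2 + s) s m) ⟩
    P + cpCount (2 + s) s m                                ∎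
    where
    open ≡-Reasoning
    Q : List Pair
    Q = Pairs (3 + s) s m
    P : ℕ
    P = positiveCount (3 + s) s m
    lengths : ∀ {a b : List ℕ} → (a , b) ∈ Q → length a ≡ 3 + s × length b ≡ s
    lengths = ∈-Pairs⁻ {3 + s} {s} {m}
    nonpositive : count (cylindric? m ∩? ∁? positive?) Q ≡ count (cylindric? m ∩? atMostParts₁? (2 + s)) Q
    nonpositive = count-nonpositive (atMostParts₁? (2 + s)) Q
      (λ { {a , b} ab∈ _ z (a>0 , _) → last-zero⇒¬positive a (proj₁ (lengths ab∈)) z a>0 })
      (λ { {a , b} ab∈ c ¬z → positive-3+s-s (proj₁ (lengths ab∈)) (proj₂ (lengths ab∈)) c (≢0⇒>0 ¬z) })

module PairSeries where

  open CauchyProduct using (q^-⊛; shift-<; shift-+)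
  open CylindricPairs
  open import Data.Integer as ℤ using (+_)
  open import Data.Integer.Properties using (pos-+)
  open import Data.Nat as ℕ using (ℕ; suc; _+_; _≤_)
  import Data.Nat.Properties as ℕ
  open import Data.Product using (_,_)
  open import Relation.Binary.PropositionalEquality
  open import Relation.Nullary using (yes; no)

  CP CP⁺ : ℕ → ℕ → PS
  CP  r s m = + cpCount r s m
  CP⁺ r s m = + positiveCount r s m

  CP31≋CP : ∀ n → CP31 n ≋ CP n n
  CP31≋CP n = ≈⇒≋ λ m → cong +_ (cp31count≡cpCount n m)

  CP⁺≋q^⊛CP : ∀ r s → s ≤ suc r → r ≤ 3 + s → CP⁺ r s ≋ q^ (r + s) ⊛ CP r s
  CP⁺≋q^⊛CP r s s≤1+r r≤3+s = ≈⇒≋ coefficient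
    where
    coefficient : CP⁺ r s ≈ q^ (r + s) ⊛ CP r s
    coefficient m with m ℕ.<? r + s
    ... | yes m<r+s = trans (cong +_ (positiveCount-small r s m m<r+s))
                        (sym (trans (q^-⊛ (r + s) (CP r s) m) (shift-< (r + s) (CP r s) m m<r+s)))
    ... | no  m≮r+s with o , refl ← ℕ.m≤n⇒∃[o]m+o≡n (ℕ.≮⇒≥ m≮r+s) =
      trans (cong +_ (positiveCount-shift r s o s≤1+r r≤3+s))
        (sym (trans (q^-⊛ (r + s) (CP r s) (r + s + o)) (shift-+ (r + s) (CP r s) o)))

  CP-suc-suc : ∀ r s → s ≤ suc r → r ≤ 3 + s →
    (1- q^ (suc r + suc s)) ⊛ CP (suc r) (suc s) ≋ CP r (suc s) ⊕ CP (suc r) s ⊖ CP r s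
  CP-suc-suc r s s≤1+r r≤3+s =
    isolate (CP (suc r) (suc s)) (CP r s) (CP r (suc s) ⊕ CP (suc r) s) (q^ (suc r + suc s))
      (≋-trans counted (⊕-cong (CP⁺≋q^⊛CP (suc r) (suc s) (ℕ.s≤s s≤1+r) (ℕ.s≤s r≤3+s)) ≋-refl))
    where
    counted : CP (suc r) (suc s) ⊕ CP r s ≋ CP⁺ (suc r) (suc s) ⊕ (CP r (suc s) ⊕ CP (suc r) s)
    counted = ≈⇒≋ λ m → begin
      + cpCount (suc r) (suc s) m ℤ.+ + cpCount r s m
        ≡⟨ pos-+ (cpCount (suc r) (suc s) m) (cpCount r s m) ⟨
      + (cpCount (suc r) (suc s) m + cpCount r s m)
        ≡⟨ cong +_ (cpCount-suc-suc r s m) ⟩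
      + (positiveCount (suc r) (suc s) m + (cpCount r (suc s) m + cpCount (suc r) s m))
        ≡⟨ pos-+ (positiveCount (suc r) (suc s) m) _ ⟩
      + positiveCount (suc r) (suc s) m ℤ.+ + (cpCount r (suc s) m + cpCount (suc r) s m)
        ≡⟨ cong (ℤ._+_ (+ positiveCount (suc r) (suc s) m)) (pos-+ (cpCount r (suc s) m) (cpCount (suc r) s m)) ⟩
      + positiveCount (suc r) (suc s) m ℤ.+ (+ cpCount r (suc s) m ℤ.+ + cpCount (suc r) s m)
        ∎
      where open ≡-Reasoning

  CP-r-sucr : ∀ r → (1- q^ (r + suc r)) ⊛ CP r (suc r) ≋ CP r r
  CP-r-sucr r = isolate₀ (CP r (suc r)) (CP r r) (q^ (r + suc r))
    (≋-trans counted (⊕-cong (CP⁺≋q^⊛CP r (suc r) ℕ.≤-refl (ℕ.m≤n⇒m≤o+n 3 (ℕ.n≤1+n r))) ≋-refl))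
    where
    counted : CP r (suc r) ≋ CP⁺ r (suc r) ⊕ CP r r
    counted = ≈⇒≋ λ m → trans (cong +_ (cpCount-r-sucr r m)) (pos-+ (positiveCount r (suc r) m) (cpCount r r m))

  CP-3+s-s : ∀ s → (1- q^ (3 + s + s)) ⊛ CP (3 + s) s ≋ CP (2 + s) s
  CP-3+s-s s = isolate₀ (CP (3 + s) s) (CP (2 + s) s) (q^ (3 + s + s))
    (≋-trans counted (⊕-cong (CP⁺≋q^⊛CP (3 + s) s (ℕ.m≤n⇒m≤o+n 3 (ℕ.n≤1+n s)) ℕ.≤-refl) ≋-refl))
    where
    counted : CP (3 + s) s ≋ CP⁺ (3 + s) s ⊕ CP (2 + s) s
    counted = ≈⇒≋ λ m → trans (cong +_ (cpCount-3+s-s s m)) (pos-+ (positiveCount (3 + s) s m) (cpCount (2 + s) s m))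

-- P i j stands for CP (k + i) (k + j) and q e for q^(2k + e); the hypotheses are the
-- recurrences of PairSeries at the ten shapes around the diagonal.
module Elimination
  (q₁ q₂ q₃ q₄ q₅ q₆ P₀₀ P₁₁ P₂₂ P₃₃ P₁₀ P₂₁ P₃₂ P₀₁ P₁₂ P₂₃ P₂₀ P₃₁ P₃₀ : PS)
  (rec₃₃ : (1- q₆) ⊛ P₃₃ ≋ P₂₃ ⊕ P₃₂ ⊖ P₂₂)
  (rec₂₂ : (1- q₄) ⊛ P₂₂ ≋ P₁₂ ⊕ P₂₁ ⊖ P₁₁)
  (rec₁₁ : (1- q₂) ⊛ P₁₁ ≋ P₀₁ ⊕ P₁₀ ⊖ P₀₀)
  (rec₃₂ : (1- q₅) ⊛ P₃₂ ≋ P₂₂ ⊕ P₃₁ ⊖ P₂₁)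
  (rec₂₁ : (1- q₃) ⊛ P₂₁ ≋ P₁₁ ⊕ P₂₀ ⊖ P₁₀)
  (rec₃₁ : (1- q₄) ⊛ P₃₁ ≋ P₂₁ ⊕ P₃₀ ⊖ P₂₀)
  (rec₂₃ : (1- q₅) ⊛ P₂₃ ≋ P₂₂)
  (rec₁₂ : (1- q₃) ⊛ P₁₂ ≋ P₁₁)
  (rec₀₁ : (1- q₁) ⊛ P₀₁ ≋ P₀₀)
  (rec₃₀ : (1- q₃) ⊛ P₃₀ ≋ P₂₀)
  where

  open Solver using (solve; _:=_; _:+_; _:-_; _:*_; con)
  open import Data.Integer using (1ℤ)

  eliminate-P₂₃-P₃₂ : (1- q₅) ⊛ (1- q₆) ⊛ P₃₃ ≋ (q^ 0 ⊕ q₅) ⊛ P₂₂ ⊕ P₃₁ ⊖ P₂₁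
  eliminate-P₂₃-P₃₂ = linear-combination
    (solve 8 (λ q₅ q₆ P₂₁ P₂₂ P₂₃ P₃₁ P₃₂ P₃₃ →
       :1- q₅ :* :1- q₆ :* P₃₃ :- ((con 1ℤ :+ q₅) :* P₂₂ :+ P₃₁ :- P₂₁)
       := :1- q₅ :* (:1- q₆ :* P₃₃ :- (P₂₃ :+ P₃₂ :- P₂₂)) :+ (:1- q₅ :* P₂₃ :- P₂₂)
          :+ (:1- q₅ :* P₃₂ :- (P₂₂ :+ P₃₁ :- P₂₁)))
       ≋-refl q₅ q₆ P₂₁ P₂₂ P₂₃ P₃₁ P₃₂ P₃₃)
    ((1- q₅) ·ᵛ vanishes rec₃₃ +ᵛ vanishes rec₂₃ +ᵛ vanishes rec₃₂)

  eliminate-P₁₂-P₂₁ : (1- q₃) ⊛ (1- q₄) ⊛ P₂₂ ≋ (q^ 0 ⊕ q₃) ⊛ P₁₁ ⊕ P₂₀ ⊖ P₁₀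
  eliminate-P₁₂-P₂₁ = linear-combination
    (solve 8 (λ q₃ q₄ P₁₀ P₁₁ P₁₂ P₂₀ P₂₁ P₂₂ →
       :1- q₃ :* :1- q₄ :* P₂₂ :- ((con 1ℤ :+ q₃) :* P₁₁ :+ P₂₀ :- P₁₀)
       := :1- q₃ :* (:1- q₄ :* P₂₂ :- (P₁₂ :+ P₂₁ :- P₁₁)) :+ (:1- q₃ :* P₁₂ :- P₁₁)
          :+ (:1- q₃ :* P₂₁ :- (P₁₁ :+ P₂₀ :- P₁₀)))
       ≋-refl q₃ q₄ P₁₀ P₁₁ P₁₂ P₂₀ P₂₁ P₂₂)
    ((1- q₃) ·ᵛ vanishes rec₂₂ +ᵛ vanishes rec₁₂ +ᵛ vanishes rec₂₁)

  eliminate-P₀₁ : (1- q₁) ⊛ (1- q₂) ⊛ P₁₁ ≋ q₁ ⊛ P₀₀ ⊕ (1- q₁) ⊛ P₁₀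
  eliminate-P₀₁ = linear-combination
    (solve 6 (λ q₁ q₂ P₀₀ P₀₁ P₁₀ P₁₁ →
       :1- q₁ :* :1- q₂ :* P₁₁ :- (q₁ :* P₀₀ :+ :1- q₁ :* P₁₀)
       := :1- q₁ :* (:1- q₂ :* P₁₁ :- (P₀₁ :+ P₁₀ :- P₀₀)) :+ (:1- q₁ :* P₀₁ :- P₀₀))
       ≋-refl q₁ q₂ P₀₀ P₀₁ P₁₀ P₁₁)
    ((1- q₁) ·ᵛ vanishes rec₁₁ +ᵛ vanishes rec₀₁)

  P₂₁-eq : (1- q₃) ⊛ P₂₁ ≋ (1- q₃) ⊛ (1- q₄) ⊛ P₂₂ ⊖ q₃ ⊛ P₁₁
  P₂₁-eq = linear-combination
    (solve 7 (λ q₃ q₄ P₁₀ P₁₁ P₂₀ P₂₁ P₂₂ →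
       :1- q₃ :* P₂₁ :- (:1- q₃ :* :1- q₄ :* P₂₂ :- q₃ :* P₁₁)
       := (:1- q₃ :* P₂₁ :- (P₁₁ :+ P₂₀ :- P₁₀))
          :- (:1- q₃ :* :1- q₄ :* P₂₂ :- ((con 1ℤ :+ q₃) :* P₁₁ :+ P₂₀ :- P₁₀)))
       ≋-refl q₃ q₄ P₁₀ P₁₁ P₂₀ P₂₁ P₂₂)
    (vanishes rec₂₁ -ᵛ vanishes eliminate-P₁₂-P₂₁)

  P₃₁-eq : (1- q₃) ⊛ (1- q₄) ⊛ P₃₁ ≋ (1- q₃) ⊛ P₂₁ ⊕ q₃ ⊛ P₂₀
  P₃₁-eq = linear-combination
    (solve 6 (λ q₃ q₄ P₂₀ P₂₁ P₃₀ P₃₁ →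
       :1- q₃ :* :1- q₄ :* P₃₁ :- (:1- q₃ :* P₂₁ :+ q₃ :* P₂₀)
       := :1- q₃ :* (:1- q₄ :* P₃₁ :- (P₂₁ :+ P₃₀ :- P₂₀)) :+ (:1- q₃ :* P₃₀ :- P₂₀))
       ≋-refl q₃ q₄ P₂₀ P₂₁ P₃₀ P₃₁)
    ((1- q₃) ·ᵛ vanishes rec₃₁ +ᵛ vanishes rec₃₀)

  P₂₀-eq : (1- q₁) ⊛ (1- q₃) ⊛ (1- q₄) ⊛ P₂₂ ≋
    (1- q₁) ⊛ P₂₀ ⊕ (1- q₁) ⊛ (q₂ ⊕ q₃) ⊛ P₁₁ ⊕ q₁ ⊛ P₀₀
  P₂₀-eq = linear-combination
    (solve 9 (λ q₁ q₂ q₃ q₄ P₀₀ P₁₀ P₁₁ P₂₀ P₂₂ →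
       :1- q₁ :* :1- q₃ :* :1- q₄ :* P₂₂ :- (:1- q₁ :* P₂₀ :+ :1- q₁ :* (q₂ :+ q₃) :* P₁₁ :+ q₁ :* P₀₀)
       := :1- q₁ :* (:1- q₃ :* :1- q₄ :* P₂₂ :- ((con 1ℤ :+ q₃) :* P₁₁ :+ P₂₀ :- P₁₀))
          :+ (:1- q₁ :* :1- q₂ :* P₁₁ :- (q₁ :* P₀₀ :+ :1- q₁ :* P₁₀)))
       ≋-refl q₁ q₂ q₃ q₄ P₀₀ P₁₀ P₁₁ P₂₀ P₂₂)
    ((1- q₁) ·ᵛ vanishes eliminate-P₁₂-P₂₁ +ᵛ vanishes eliminate-P₀₁)

  eliminate-P₃₁-P₂₁ : (1- q₃) ⊛ (1- q₄) ⊛ (1- q₅) ⊛ (1- q₆) ⊛ P₃₃ ≋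
    (1- q₃) ⊛ (1- q₄) ⊛ (q^ 0 ⊕ q₄ ⊕ q₅) ⊛ P₂₂ ⊖ q₃ ⊛ q₄ ⊛ P₁₁ ⊕ q₃ ⊛ P₂₀
  eliminate-P₃₁-P₂₁ = linear-combination
    (solve 10 (λ q₃ q₄ q₅ q₆ P₁₁ P₂₀ P₂₁ P₂₂ P₃₁ P₃₃ →
       :1- q₃ :* :1- q₄ :* :1- q₅ :* :1- q₆ :* P₃₃
         :- (:1- q₃ :* :1- q₄ :* (con 1ℤ :+ q₄ :+ q₅) :* P₂₂ :- q₃ :* q₄ :* P₁₁ :+ q₃ :* P₂₀)
       := :1- q₃ :* :1- q₄ :* (:1- q₅ :* :1- q₆ :* P₃₃ :- ((con 1ℤ :+ q₅) :* P₂₂ :+ P₃₁ :- P₂₁))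
          :+ (:1- q₃ :* :1- q₄ :* P₃₁ :- (:1- q₃ :* P₂₁ :+ q₃ :* P₂₀))
          :+ q₄ :* (:1- q₃ :* P₂₁ :- (:1- q₃ :* :1- q₄ :* P₂₂ :- q₃ :* P₁₁)))
       ≋-refl q₃ q₄ q₅ q₆ P₁₁ P₂₀ P₂₁ P₂₂ P₃₁ P₃₃)
    (((1- q₃) ⊛ (1- q₄)) ·ᵛ vanishes eliminate-P₂₃-P₃₂ +ᵛ vanishes P₃₁-eq +ᵛ q₄ ·ᵛ vanishes P₂₁-eq)

  diagonal-relation : (1- q₁) ⊛ (1- q₃) ⊛ (1- q₄) ⊛ (1- q₅) ⊛ (1- q₆) ⊛ P₃₃ ≋
    (1- q₁) ⊛ (1- q₃) ⊛ (1- q₄) ⊛ (q^ 0 ⊕ q₃ ⊕ q₄ ⊕ q₅) ⊛ P₂₂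
      ⊖ (1- q₁) ⊛ (q₃ ⊛ q₄ ⊕ q₃ ⊛ q₃ ⊕ q₂ ⊛ q₃) ⊛ P₁₁ ⊖ q₁ ⊛ q₃ ⊛ P₀₀
  diagonal-relation = linear-combination
    (solve 11 (λ q₁ q₂ q₃ q₄ q₅ q₆ P₀₀ P₁₁ P₂₀ P₂₂ P₃₃ →
       :1- q₁ :* :1- q₃ :* :1- q₄ :* :1- q₅ :* :1- q₆ :* P₃₃
         :- (:1- q₁ :* :1- q₃ :* :1- q₄ :* (con 1ℤ :+ q₃ :+ q₄ :+ q₅) :* P₂₂
             :- :1- q₁ :* (q₃ :* q₄ :+ q₃ :* q₃ :+ q₂ :* q₃) :* P₁₁ :- q₁ :* q₃ :* P₀₀)
       := :1- q₁ :* (:1- q₃ :* :1- q₄ :* :1- q₅ :* :1- q₆ :* P₃₃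
                     :- (:1- q₃ :* :1- q₄ :* (con 1ℤ :+ q₄ :+ q₅) :* P₂₂ :- q₃ :* q₄ :* P₁₁ :+ q₃ :* P₂₀))
          :- q₃ :* (:1- q₁ :* :1- q₃ :* :1- q₄ :* P₂₂
                    :- (:1- q₁ :* P₂₀ :+ :1- q₁ :* (q₂ :+ q₃) :* P₁₁ :+ q₁ :* P₀₀)))
       ≋-refl q₁ q₂ q₃ q₄ q₅ q₆ P₀₀ P₁₁ P₂₀ P₂₂ P₃₃)
    ((1- q₁) ·ᵛ vanishes eliminate-P₃₁-P₂₁ -ᵛ q₃ ·ᵛ vanishes P₂₀-eq)

open import Data.Nat using (ℕ; _≤_; _∸_; _*_; _+_; suc; z≤n; s≤s)
import Data.Nat.Properties as ℕ
open import Relation.Binary.PropositionalEquality using (_≡_; trans; cong)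

[c+x]∸[c∸e]≡e+x : ∀ c e x → e ≤ c → c + x ∸ (c ∸ e) ≡ e + x
[c+x]∸[c∸e]≡e+x c e x e≤c = trans (ℕ.+-∸-comm x (ℕ.m∸n≤m c e)) (cong (_+ x) (ℕ.m∸[m∸n]≡n e≤c))

module NearDiagonal (k : ℕ) where

  open PairSeries
  open import Data.Bool using (T)
  open import Data.Nat using (_≤ᵇ_)
  open import Data.Nat.Tactic.RingSolver using (solve-∀)
  open import Relation.Binary.PropositionalEquality

  t : ℕ
  t = k + k

  -- With n = 3 + k, q e is q^(2n - 6 + e) and I e is 1/(1 - q e), with the
  -- exponent written as in the statement.
  q I : ℕ → PS
  q e = q^ (2 * (3 + k) ∸ (6 ∸ e))
  I e = inv1m (2 * (3 + k) ∸ (6 ∸ e))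

  P : ℕ → ℕ → PS
  P i j = CP (i + k) (j + k)

  exponent : ∀ e → e ≤ 6 → 2 * (3 + k) ∸ (6 ∸ e) ≡ e + t
  exponent e e≤6 = trans (cong (_∸ (6 ∸ e)) (double k)) ([c+x]∸[c∸e]≡e+x 6 e t e≤6)
    where
    double : ∀ k → 2 * (3 + k) ≡ 6 + (k + k)
    double = solve-∀

  with-exponent : ∀ {a b} {f g : PS} → a ≡ b → (1- q^ a) ⊛ f ≋ g → (1- q^ b) ⊛ f ≋ g
  with-exponent refl h = h

  -- The conditions on the literal offsets are of the form T (_ ≤ᵇ _), which
  -- reduce to ⊤ for literals and are passed as _.
  rec-both : ∀ i j → T (j ≤ᵇ suc i) → T (i ≤ᵇ 3 + j) → T (2 + i + j ≤ᵇ 6) →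
    (1- q (2 + i + j)) ⊛ P (suc i) (suc j) ≋ P i (suc j) ⊕ P (suc i) j ⊖ P i j
  rec-both i j j≤1+i i≤3+j ≤6 =
    with-exponent (trans (shape i j k) (sym (exponent (2 + i + j) (ℕ.≤ᵇ⇒≤ _ 6 ≤6))))
      (CP-suc-suc (i + k) (j + k) (ℕ.+-monoˡ-≤ k (ℕ.≤ᵇ⇒≤ j _ j≤1+i)) (ℕ.+-monoˡ-≤ k (ℕ.≤ᵇ⇒≤ i _ i≤3+j)))
    where
    shape : ∀ i j k → suc (i + k) + suc (j + k) ≡ 2 + i + j + (k + k)
    shape = solve-∀

  rec-gap : ∀ i → T (1 + i + i ≤ᵇ 6) → (1- q (1 + i + i)) ⊛ P i (suc i) ≋ P i i
  rec-gap i ≤6 = with-exponent (trans (shape i k) (sym (exponent (1 + i + i) (ℕ.≤ᵇ⇒≤ _ 6 ≤6)))) (CP-r-sucr (i + k))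
    where
    shape : ∀ i k → i + k + suc (i + k) ≡ 1 + i + i + (k + k)
    shape = solve-∀

  rec-overhang : (1- q 3) ⊛ P 3 0 ≋ P 2 0
  rec-overhang = with-exponent (sym (exponent 3 (ℕ.≤ᵇ⇒≤ 3 6 _))) (CP-3+s-s k)

  unit : ∀ e → T (1 ≤ᵇ e) → T (e ≤ᵇ 6) → (1- q e) ⊛ I e ≋ q^ 0
  unit (suc e) _ ≤6 =
    subst (λ x → (1- q^ x) ⊛ inv1m x ≋ q^ 0) (sym (exponent (suc e) (ℕ.≤ᵇ⇒≤ _ 6 ≤6))) (inv1m-inverse (e + t))

  product : ∀ e f → T (e ≤ᵇ 6) → T (f ≤ᵇ 6) → q e ⊛ q f ≋ q^ (4 * (3 + k) ∸ (12 ∸ (e + f)))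
  product e f e≤6 f≤6 = ≋-trans (q^-+ (2 * (3 + k) ∸ (6 ∸ e)) (2 * (3 + k) ∸ (6 ∸ f)))
    (≈⇒≋ λ m → cong (λ x → q^ x m) (begin
    2 * (3 + k) ∸ (6 ∸ e) + (2 * (3 + k) ∸ (6 ∸ f)) ≡⟨ cong₂ _+_ (exponent e e≤6′) (exponent f f≤6′) ⟩
    e + t + (f + t)                                 ≡⟨ regroup e f k ⟩
    e + f + (t + t)                                 ≡⟨ [c+x]∸[c∸e]≡e+x 12 (e + f) (t + t) (ℕ.+-mono-≤ e≤6′ f≤6′) ⟨
    12 + (t + t) ∸ (12 ∸ (e + f))                   ≡⟨ cong (_∸ (12 ∸ (e + f))) (quadruple k) ⟨
    4 * (3 + k) ∸ (12 ∸ (e + f))                    ∎))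
    where
    open ≡-Reasoning
    e≤6′ : e ≤ 6
    e≤6′ = ℕ.≤ᵇ⇒≤ e 6 e≤6
    f≤6′ : f ≤ 6
    f≤6′ = ℕ.≤ᵇ⇒≤ f 6 f≤6
    regroup : ∀ e f k → e + (k + k) + (f + (k + k)) ≡ e + f + ((k + k) + (k + k))
    regroup = solve-∀
    quadruple : ∀ k → 4 * (3 + k) ≡ 12 + ((k + k) + (k + k))
    quadruple = solve-∀

  open Elimination (q 1) (q 2) (q 3) (q 4) (q 5) (q 6) (P 0 0) (P 1 1) (P 2 2) (P 3 3) (P 1 0) (P 2 1) (P 3 2)
    (P 0 1) (P 1 2) (P 2 3) (P 2 0) (P 3 1) (P 3 0)
    (rec-both 2 2 _ _ _) (rec-both 1 1 _ _ _) (rec-both 0 0 _ _ _) (rec-both 2 1 _ _ _) (rec-both 1 0 _ _ _)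
    (rec-both 2 0 _ _ _) (rec-gap 2 _) (rec-gap 1 _) (rec-gap 0 _) rec-overhang

  A B p : PS
  A = q^ 0 ⊕ q 3 ⊕ q 4 ⊕ q 5
  B = q^ (4 * (3 + k) ∸ 5) ⊕ q^ (4 * (3 + k) ∸ 6) ⊕ q^ (4 * (3 + k) ∸ 7)
  p = q^ (4 * (3 + k) ∸ 8)

  diagonal-relation-CP31 : (1- q 1) ⊛ (1- q 3) ⊛ (1- q 4) ⊛ (1- q 5) ⊛ (1- q 6) ⊛ CP31 (3 + k) ≋
    (1- q 1) ⊛ (1- q 3) ⊛ (1- q 4) ⊛ A ⊛ CP31 (2 + k) ⊖ (1- q 1) ⊛ B ⊛ CP31 (1 + k) ⊖ p ⊛ CP31 k
  diagonal-relation-CP31 =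
    ≋-trans (⊛-cong (≋-refl {(1- q 1) ⊛ (1- q 3) ⊛ (1- q 4) ⊛ (1- q 5) ⊛ (1- q 6)}) (CP31≋CP (3 + k)))
      (≋-trans diagonal-relation
        (⊖-cong (⊖-cong (⊛-cong (≋-refl {(1- q 1) ⊛ (1- q 3) ⊛ (1- q 4) ⊛ A}) (≋-sym (CP31≋CP (2 + k))))
                        (⊛-cong (⊛-cong (≋-refl {1- q 1}) (⊕-cong (⊕-cong (product 3 4 _ _) (product 3 3 _ _)) (product 2 3 _ _)))
                                (≋-sym (CP31≋CP (1 + k)))))
                (⊛-cong (product 1 3 _ _) (≋-sym (CP31≋CP k)))))

theorem5p4 : (n : ℕ) → 3 ≤ n →
    CP31 n ≈
      ((q^ 0 ⊕ q^ (2 * n ∸ 3) ⊕ q^ (2 * n ∸ 2) ⊕ q^ (2 * n ∸ 1))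
         ⊛ inv1m (2 * n ∸ 1) ⊛ inv1m (2 * n)) ⊛ CP31 (n ∸ 1)
      ⊖ ((q^ (4 * n ∸ 5) ⊕ q^ (4 * n ∸ 6) ⊕ q^ (4 * n ∸ 7))
         ⊛ inv1m (2 * n ∸ 3) ⊛ inv1m (2 * n ∸ 2) ⊛ inv1m (2 * n ∸ 1) ⊛ inv1m (2 * n)) ⊛ CP31 (n ∸ 2)
      ⊖ (q^ (4 * n ∸ 8)
         ⊛ inv1m (2 * n ∸ 5) ⊛ inv1m (2 * n ∸ 3) ⊛ inv1m (2 * n ∸ 2) ⊛ inv1m (2 * n ∸ 1) ⊛ inv1m (2 * n)) ⊛ CP31 (n ∸ 3)
theorem5p4 (suc (suc (suc k))) (s≤s (s≤s (s≤s z≤n))) = ≋⇒≈ (divide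
  (1- q 1) (1- q 3) (1- q 4) (1- q 5) (1- q 6) (I 1) (I 3) (I 4) (I 5) (I 6) A B p
  (CP31 (3 + k)) (CP31 k) (CP31 (1 + k)) (CP31 (2 + k))
  (unit 1 _ _) (unit 3 _ _) (unit 4 _ _) (unit 5 _ _) (unit 6 _ _) diagonal-relation-CP31)
  where open NearDiagonal k
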